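{- Let $m,n\ge1$ and $a,b\ge0$ be given integers. Then $G^+_{d,m,a,b}(n)$, as a function of the positive integer $d$, is a polynomial in $d$ of degree $2a+b+\lfloor\frac{n+1}{2}\rfloor$.
   Context: For integers $d\ge1$, $n\ge0$ let $\mathcal{A}_{d,n}=\{(i,j):1\le i\le d,\ 1\le j\le n\}$. A subset $I\subseteq\mathcal{A}_{d,n}$ is nice if (1) $(i+1,j)\in I$ with $i\ge1$ implies $(i,j)\in I$, and (2) $(1,j)\in I$ with $1\le j\le n-1$ implies $(1,j+1)\notin I$. $\mathcal{B}^+_{d,n}$ is the set of nice subsets of $\mathcal{A}_{d,n}$. For $I$ nice, $|I|$ is its cardinality and $\sigma_m(I)=\sum_{(i,j)\in I}((i-1)m+j)$. Define $G^+_{d,m,a,b}(n)=\sum_{I\in\mathcal{B}^+_{d,n}}\sigma_m(I)^a|I|^b$ (with $0^0=1$). -}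

module Defs where

open import Data.Bool using (Bool; true; false; _∧_; _∨_; not; if_then_else_)
open import Data.Nat as ℕ using (ℕ; zero; suc)
open import Data.Fin using (Fin; toℕ)
open import Data.Vec using (Vec; []; _∷_; lookup; zipWith)
import Data.Vec as Vec
open import Data.List using (List; []; _∷_; [_]; map; concatMap; filter; allFin)
open import Data.Nat.ListAction using (sum)
open import Data.Product using (Σ; _×_)
open import Relation.Nullary using (¬_)
open import Data.Integer using (+_)
open import Data.Rational using (ℚ; 0ℚ; _+_; _*_; _/_)
open import Relation.Nullary.Decidable using (Dec)
open import Data.Bool.Properties using () renaming (_≟_ to _≟B_)
open import Relation.Binary.PropositionalEquality using (_≡_)

-- A subset I of A_{d,n} is represented by its characteristic matrix
-- M : Vec (Vec Bool n) d, with  (i,j) ∈ I  iff  lookup (lookup M i) j ≡ true,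
-- where Fin-index i corresponds to the paper's row i+1, j to column j+1.
Subsetᴬ : ℕ → ℕ → Set
Subsetᴬ d n = Vec (Vec Bool n) d

allVecs : {A : Set} → List A → (k : ℕ) → List (Vec A k)
allVecs xs zero    = [ [] ]
allVecs xs (suc k) = concatMap (λ x → map (x ∷_) (allVecs xs k)) xs

allSubsets : (d n : ℕ) → List (Subsetᴬ d n)
allSubsets d n = allVecs (allVecs (true ∷ false ∷ []) n) d

_⇒ᵇ_ : Bool → Bool → Bool
x ⇒ᵇ y = not x ∨ y

allᵇ : {k : ℕ} → Vec Bool k → Bool
allᵇ = Vec.foldr _ _∧_ true

-- condition (1): for consecutive rows r (row i) and s (row i+1),
-- (i+1,j) ∈ I implies (i,j) ∈ I, for every column j
downClosed : {d n : ℕ} → Subsetᴬ d n → Bool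
downClosed []           = true
downClosed (r ∷ [])     = true
downClosed (r ∷ s ∷ rs) = allᵇ (zipWith _⇒ᵇ_ s r) ∧ downClosed (s ∷ rs)

noAdjacent : {n : ℕ} → Vec Bool n → Bool
noAdjacent []           = true
noAdjacent (x ∷ [])     = true
noAdjacent (x ∷ y ∷ xs) = not (x ∧ y) ∧ noAdjacent (y ∷ xs)

-- condition (2): (1,j) ∈ I implies (1,j+1) ∉ I
firstRowOK : {d n : ℕ} → Subsetᴬ d n → Bool
firstRowOK []      = true
firstRowOK (r ∷ _) = noAdjacent r

nice : {d n : ℕ} → Subsetᴬ d n → Bool
nice M = downClosed M ∧ firstRowOK M

B⁺ : (d n : ℕ) → List (Subsetᴬ d n)
B⁺ d n = filter (λ M → nice M ≟B true) (allSubsets d n)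

mem : {d n : ℕ} → Subsetᴬ d n → Fin d → Fin n → Bool
mem M i j = lookup (lookup M i) j

card : {d n : ℕ} → Subsetᴬ d n → ℕ
card {d} {n} M =
  sum (map (λ i → sum (map (λ j → if mem M i j then 1 else 0) (allFin n))) (allFin d))

-- σ_m(I) = Σ_{(i,j)∈I} ((i-1) m + j)   (paper's 1-based (i,j) = (toℕ i + 1, toℕ j + 1))
σ : {d n : ℕ} → ℕ → Subsetᴬ d n → ℕ
σ {d} {n} m M =
  sum (map (λ i → sum (map (λ j → if mem M i j then toℕ i ℕ.* m ℕ.+ suc (toℕ j) else 0)
                              (allFin n)))
           (allFin d))

-- G^+_{d,m,a,b}(n) = Σ_{I ∈ B^+_{d,n}} σ_m(I)^a |I|^b   (ℕ's _^_ has 0^0 = 1)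
G⁺ : (d m a b n : ℕ) → ℕ
G⁺ d m a b n = sum (map (λ I → (σ m I ℕ.^ a) ℕ.* (card I ℕ.^ b)) (B⁺ d n))

toℚ : ℕ → ℚ
toℚ k = + k / 1

evalPoly : {k : ℕ} → Vec ℚ k → ℚ → ℚ
evalPoly []       x = 0ℚ
evalPoly (c ∷ cs) x = c + x * evalPoly cs x

IsPolyOfDegree : (ℕ → ℕ) → ℕ → Set
IsPolyOfDegree f D =
  Σ (Vec ℚ (suc D)) (λ cs →
    (¬ (Vec.last cs ≡ 0ℚ)) × (∀ d → 1 ℕ.≤ d → toℚ (f d) ≡ evalPoly cs (toℚ d)))

module Submission where

-- Read by columns, a nice set is a list of columns, each an initial segment
-- {1,…,h} of rows, no two adjacent ones both non-empty.  A non-empty column j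
-- of height h contributes Σ_{i<h} (i·m + j) to σ_m and h to |I|, so G⁺ is a
-- sum of x^a y^b over a list of "configurations" (x, y) = (σ_m, |I|) built
-- column by column (Columns, Configurations).  Expanding the contribution
-- (W + x)^a (h + y)^b of a new column binomially gives a recursion for these
-- moments in which the new column enters through an indefinite sum over its
-- height h < d (MomentRecursion).
--
-- Polynomiality is a closure argument (RationalPolynomials,
-- PolynomialFunctions): functions ℕ → ℕ agreeing with a rational polynomial
-- of degree ≤ D whose coefficient of d^D is non-negative (resp. positive) are
-- closed under sums, products, powers and indefinite summation, which raises
-- the degree by one via the discrete antiderivative.  An induction on the
-- number of columns (DegreeBounds) tracks the degree 2a + b + ⌈n/2⌉ of a free
-- first column and 2a + b + ⌊n/2⌋ of a blocked one; the leading coefficient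
-- is positive because of the term where every binomial factor comes from the
-- new column.


module RationalPolynomials where

  open import Data.Nat as ℕ using (ℕ; zero; suc; z≤n; s≤s)
  import Data.Nat.Properties as ℕP
  open import Data.List using (List; []; _∷_)
  open import Data.Product using (_×_; _,_; proj₁; proj₂)
  open import Data.Sum using (inj₁; inj₂)
  open import Data.Rational
  open import Data.Rational.Properties
  import Data.Nat.Coprimality as Coprime
  import Data.Integer as ℤ
  import Data.Integer.Properties as ℤP
  open import Relation.Binary.PropositionalEquality
  open import Data.Rational.Solver using (module +-*-Solver)
  open +-*-Solver
  open import Defs using (toℚ)

  toℚ-mkℚ : ∀ k → toℚ k ≡ mkℚ (ℤ.+ k) 0 (Coprime.sym (Coprime.1-coprimeTo k))
  toℚ-mkℚ k = normalize-coprime (Coprime.sym (Coprime.1-coprimeTo k))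

  toℚ-+ : ∀ a b → toℚ (a ℕ.+ b) ≡ toℚ a + toℚ b
  toℚ-+ a b = sym (trans (cong₂ _+_ (toℚ-mkℚ a) (toℚ-mkℚ b))
    (/-cong (trans (cong₂ ℤ._+_ (ℤP.*-identityʳ (ℤ.+ a)) (ℤP.*-identityʳ (ℤ.+ b)))
                   (sym (ℤP.pos-+ a b))) refl))

  toℚ-* : ∀ a b → toℚ (a ℕ.* b) ≡ toℚ a * toℚ b
  toℚ-* a b = sym (trans (cong₂ _*_ (toℚ-mkℚ a) (toℚ-mkℚ b)) (/-cong (sym (ℤP.pos-* a b)) refl))

  toℚ-nonNeg : ∀ k → NonNegative (toℚ k)
  toℚ-nonNeg k = normalize-nonNeg k 1

  toℚ-pos : ∀ k → Positive (toℚ (suc k))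
  toℚ-pos k = normalize-pos (suc k) 1

  recip : ℕ → ℚ
  recip k = (1/ toℚ (suc k)) {{pos⇒nonZero (toℚ (suc k)) {{toℚ-pos k}}}}

  recip-pos : ∀ k → Positive (recip k)
  recip-pos k = 1/pos⇒pos (toℚ (suc k)) {{toℚ-pos k}}

  recip-inverse : ∀ k → recip k * toℚ (suc k) ≡ 1ℚ
  recip-inverse k = *-inverseˡ (toℚ (suc k)) {{pos⇒nonZero (toℚ (suc k)) {{toℚ-pos k}}}}

  recip-cancel : ∀ k c → c * recip k * toℚ (suc k) ≡ c
  recip-cancel k c = trans (*-assoc c (recip k) _) (trans (cong (c *_) (recip-inverse k)) (*-identityʳ c))

  recip-solve : ∀ k x c → x * toℚ (suc k) ≡ c → x ≡ c * recip k
  recip-solve k x c eq = begin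
    x                             ≡⟨ sym (*-identityʳ x) ⟩
    x * 1ℚ                        ≡⟨ cong (x *_) (sym (trans (*-comm _ (recip k)) (recip-inverse k))) ⟩
    x * (toℚ (suc k) * recip k)   ≡⟨ sym (*-assoc x _ _) ⟩
    x * toℚ (suc k) * recip k     ≡⟨ cong (_* recip k) eq ⟩
    c * recip k                   ∎
    where open ≡-Reasoning

  Poly : Set
  Poly = List ℚ

  coeff : Poly → ℕ → ℚ
  coeff []      _       = 0ℚ
  coeff (c ∷ p) zero    = c
  coeff (c ∷ p) (suc i) = coeff p i

  eval : Poly → ℚ → ℚ
  eval []      x = 0ℚ
  eval (c ∷ p) x = c + x * eval p x

  _^ℚ_ : ℚ → ℕ → ℚ
  x ^ℚ zero  = 1ℚ
  x ^ℚ suc n = x * x ^ℚ n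

  _⊕_ : Poly → Poly → Poly
  []      ⊕ q       = q
  (c ∷ p) ⊕ []      = c ∷ p
  (c ∷ p) ⊕ (e ∷ q) = (c + e) ∷ (p ⊕ q)

  scale : ℚ → Poly → Poly
  scale a []      = []
  scale a (c ∷ p) = a * c ∷ scale a p

  _⊗_ : Poly → Poly → Poly
  []      ⊗ q = []
  (c ∷ p) ⊗ q = scale c q ⊕ (0ℚ ∷ (p ⊗ q))

  mono : ℚ → ℕ → Poly
  mono c zero    = c ∷ []
  mono c (suc n) = 0ℚ ∷ mono c n

  binomial : ℕ → Poly
  binomial zero    = 1ℚ ∷ []
  binomial (suc n) = (1ℚ ∷ 1ℚ ∷ []) ⊗ binomial n

  eval-⊕ : ∀ p q x → eval (p ⊕ q) x ≡ eval p x + eval q x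
  eval-⊕ []      q       x = sym (+-identityˡ _)
  eval-⊕ (c ∷ p) []      x = sym (+-identityʳ _)
  eval-⊕ (c ∷ p) (e ∷ q) x rewrite eval-⊕ p q x =
    solve 5 (λ c e x a b → (c :+ e) :+ x :* (a :+ b) := (c :+ x :* a) :+ (e :+ x :* b))
      refl c e x (eval p x) (eval q x)

  eval-scale : ∀ a p x → eval (scale a p) x ≡ a * eval p x
  eval-scale a []      x = sym (*-zeroʳ a)
  eval-scale a (c ∷ p) x rewrite eval-scale a p x =
    solve 4 (λ a c x e → a :* c :+ x :* (a :* e) := a :* (c :+ x :* e)) refl a c x (eval p x)

  eval-⊗ : ∀ p q x → eval (p ⊗ q) x ≡ eval p x * eval q x
  eval-⊗ []      q x = sym (*-zeroˡ (eval q x))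
  eval-⊗ (c ∷ p) q x
    rewrite eval-⊕ (scale c q) (0ℚ ∷ (p ⊗ q)) x | eval-scale c q x | eval-⊗ p q x =
    solve 4 (λ c x a b → c :* b :+ (con 0ℚ :+ x :* (a :* b)) := (c :+ x :* a) :* b)
      refl c x (eval p x) (eval q x)

  eval-mono : ∀ c n x → eval (mono c n) x ≡ c * x ^ℚ n
  eval-mono c zero    x = solve 2 (λ c x → c :+ x :* con 0ℚ := c :* con 1ℚ) refl c x
  eval-mono c (suc n) x rewrite eval-mono c n x =
    solve 3 (λ c x a → con 0ℚ :+ x :* (c :* a) := c :* (x :* a)) refl c x (x ^ℚ n)

  eval-binomial : ∀ n x → eval (binomial n) x ≡ (1ℚ + x) ^ℚ n
  eval-binomial zero    x = solve 1 (λ x → con 1ℚ :+ x :* con 0ℚ := con 1ℚ) refl x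
  eval-binomial (suc n) x rewrite eval-⊗ (1ℚ ∷ 1ℚ ∷ []) (binomial n) x | eval-binomial n x =
    cong (_* (1ℚ + x) ^ℚ n) (solve 1 (λ x → con 1ℚ :+ x :* (con 1ℚ :+ x :* con 0ℚ) := con 1ℚ :+ x) refl x)

  coeff-⊕ : ∀ p q i → coeff (p ⊕ q) i ≡ coeff p i + coeff q i
  coeff-⊕ []      q       i       = sym (+-identityˡ _)
  coeff-⊕ (c ∷ p) []      i       = sym (+-identityʳ _)
  coeff-⊕ (c ∷ p) (e ∷ q) zero    = refl
  coeff-⊕ (c ∷ p) (e ∷ q) (suc i) = coeff-⊕ p q i

  coeff-scale : ∀ a p i → coeff (scale a p) i ≡ a * coeff p i
  coeff-scale a []      i       = sym (*-zeroʳ a)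
  coeff-scale a (c ∷ p) zero    = refl
  coeff-scale a (c ∷ p) (suc i) = coeff-scale a p i

  coeff-⊗-cons : ∀ c p q i → coeff ((c ∷ p) ⊗ q) i ≡ c * coeff q i + coeff (0ℚ ∷ (p ⊗ q)) i
  coeff-⊗-cons c p q i rewrite coeff-⊕ (scale c q) (0ℚ ∷ (p ⊗ q)) i | coeff-scale c q i = refl

  Deg≤ : Poly → ℕ → Set
  Deg≤ p D = ∀ i → D ℕ.< i → coeff p i ≡ 0ℚ

  IsZero : Poly → Set
  IsZero p = ∀ i → coeff p i ≡ 0ℚ

  deg-weaken : ∀ {p D D′} → D ℕ.≤ D′ → Deg≤ p D → Deg≤ p D′
  deg-weaken D≤D′ dp i lt = dp i (ℕP.≤-<-trans D≤D′ lt)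

  deg-⊕ : ∀ {p q D} → Deg≤ p D → Deg≤ q D → Deg≤ (p ⊕ q) D
  deg-⊕ {p} {q} dp dq i lt rewrite coeff-⊕ p q i | dp i lt | dq i lt = +-identityˡ 0ℚ

  deg-const : ∀ c → Deg≤ (c ∷ []) 0
  deg-const c (suc i) _ = refl

  deg-linear : ∀ a b → Deg≤ (a ∷ b ∷ []) 1
  deg-linear a b (suc zero)    (s≤s ())
  deg-linear a b (suc (suc i)) _ = refl

  eval-zero : ∀ p x → IsZero p → eval p x ≡ 0ℚ
  eval-zero []      x z = refl
  eval-zero (c ∷ p) x z rewrite z zero | eval-zero p x (λ j → z (suc j)) | *-zeroʳ x = +-identityʳ 0ℚ

  eval-deg0 : ∀ p → Deg≤ p 0 → ∀ x → eval p x ≡ coeff p 0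
  eval-deg0 []      _  x = refl
  eval-deg0 (c ∷ p) dp x rewrite eval-zero p x (λ j → dp (suc j) (s≤s z≤n)) | *-zeroʳ x = +-identityʳ c

  zero-⊗ : ∀ p q → IsZero p → IsZero (p ⊗ q)
  zero-⊗ []      q z i = refl
  zero-⊗ (c ∷ p) q z i rewrite coeff-⊗-cons c p q i | z zero = trans (cong (0ℚ * coeff q i +_) (tail i)) (trans (+-identityʳ (0ℚ * coeff q i)) (*-zeroˡ (coeff q i)))
    where
    tail : ∀ i → coeff (0ℚ ∷ (p ⊗ q)) i ≡ 0ℚ
    tail zero    = refl
    tail (suc i) = zero-⊗ p q (λ j → z (suc j)) i

  deg-⊗ : ∀ p q A B → Deg≤ p A → Deg≤ q B →
    Deg≤ (p ⊗ q) (A ℕ.+ B) × (coeff (p ⊗ q) (A ℕ.+ B) ≡ coeff p A * coeff q B)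
  deg-⊗ []      q A B dp dq = (λ _ _ → refl) , sym (*-zeroˡ (coeff q B))
  deg-⊗ (c ∷ p) q zero B dp dq = bound , only-c B
    where
    p≡0 : IsZero p
    p≡0 j = dp (suc j) (s≤s z≤n)
    only-c : ∀ i → coeff ((c ∷ p) ⊗ q) i ≡ c * coeff q i
    only-c zero    rewrite coeff-⊗-cons c p q zero = +-identityʳ _
    only-c (suc i) rewrite coeff-⊗-cons c p q (suc i) | zero-⊗ p q p≡0 i = +-identityʳ _
    bound : Deg≤ ((c ∷ p) ⊗ q) B
    bound i lt rewrite only-c i | dq i lt = *-zeroʳ c
  deg-⊗ (c ∷ p) q (suc A) B dp dq = bound , top
    where
    ih = deg-⊗ p q A B (λ j lt → dp (suc j) (s≤s lt)) dq
    bound : Deg≤ ((c ∷ p) ⊗ q) (suc A ℕ.+ B)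
    bound (suc i) (s≤s lt) rewrite coeff-⊗-cons c p q (suc i)
      | dq (suc i) (s≤s (ℕP.≤-trans (ℕP.m≤n+m B A) (ℕP.<⇒≤ lt)))
      | proj₁ ih i lt = trans (+-identityʳ _) (*-zeroʳ c)
    top : coeff ((c ∷ p) ⊗ q) (suc A ℕ.+ B) ≡ coeff p A * coeff q B
    top rewrite coeff-⊗-cons c p q (suc (A ℕ.+ B))
      | dq (suc (A ℕ.+ B)) (s≤s (ℕP.m≤n+m B A)) | proj₂ ih | *-zeroʳ c = +-identityˡ _

  deg-mono : ∀ c n → Deg≤ (mono c n) n
  deg-mono c zero    (suc i) _       = refl
  deg-mono c (suc n) (suc i) (s≤s lt) = deg-mono c n i lt

  coeff-mono-top : ∀ c n → coeff (mono c n) n ≡ c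
  coeff-mono-top c zero    = refl
  coeff-mono-top c (suc n) = coeff-mono-top c n

  coeff-mono-below : ∀ c n i → i ℕ.< n → coeff (mono c n) i ≡ 0ℚ
  coeff-mono-below c (suc n) zero    _        = refl
  coeff-mono-below c (suc n) (suc i) (s≤s lt) = coeff-mono-below c n i lt

  pascal : ∀ n i → coeff (binomial (suc n)) (suc i) ≡ coeff (binomial n) (suc i) + coeff (binomial n) i
  pascal n i rewrite coeff-⊗-cons 1ℚ (1ℚ ∷ []) (binomial n) (suc i) | coeff-⊗-cons 1ℚ [] (binomial n) i =
    cong₂ _+_ (*-identityˡ (coeff (binomial n) (suc i)))
              (trans (cong (1ℚ * coeff (binomial n) i +_) (zero-coeff i))
                     (trans (+-identityʳ (1ℚ * coeff (binomial n) i)) (*-identityˡ (coeff (binomial n) i))))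
    where
    zero-coeff : ∀ i → coeff (0ℚ ∷ []) i ≡ 0ℚ
    zero-coeff zero    = refl
    zero-coeff (suc i) = refl

  coeff-binomial-0 : ∀ n → coeff (binomial n) 0 ≡ 1ℚ
  coeff-binomial-0 zero    = refl
  coeff-binomial-0 (suc n) rewrite coeff-⊗-cons 1ℚ (1ℚ ∷ []) (binomial n) 0 | coeff-binomial-0 n = refl

  deg-binomial : ∀ n → Deg≤ (binomial n) n
  deg-binomial zero    (suc i) _        = refl
  deg-binomial (suc n) (suc i) (s≤s lt) rewrite pascal n i
    | deg-binomial n (suc i) (ℕP.m≤n⇒m≤1+n lt) | deg-binomial n i lt = +-identityˡ 0ℚ

  coeff-binomial-top : ∀ n → coeff (binomial n) n ≡ 1ℚ
  coeff-binomial-top zero    = refl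
  coeff-binomial-top (suc n) rewrite pascal n n | deg-binomial n (suc n) (ℕP.n<1+n n)
    | coeff-binomial-top n = +-identityˡ 1ℚ

  coeff-binomial-next : ∀ n → coeff (binomial (suc n)) n ≡ toℚ (suc n)
  coeff-binomial-next zero    = coeff-binomial-0 1
  coeff-binomial-next (suc n) rewrite pascal (suc n) n | coeff-binomial-top (suc n)
    | coeff-binomial-next n = sym (toℚ-+ 1 (suc n))

  -- Discrete antiderivative: a polynomial p of degree ≤ k has a polynomial
  -- P of degree ≤ k+1 with P(x+1) = P(x) + p(x) and P(0) = 0, whose top
  -- coefficient times k+1 is that of p.  This makes indefinite sums of
  -- polynomial functions polynomial.

  record Antidifference (k : ℕ) (p : Poly) : Set where
    field
      prim      : Poly
      prim-deg  : Deg≤ prim (suc k)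
      prim-step : ∀ x → eval prim (1ℚ + x) ≡ eval prim x + eval p x
      prim-zero : eval prim 0ℚ ≡ 0ℚ
      prim-top  : coeff prim (suc k) * toℚ (suc k) ≡ coeff p k

  -- For p of degree ≤ K = k+1 with top coefficient c′·(K+1): subtracting
  -- c′·((1+x)^(K+1) − x^(K+1)) lowers the degree to k, and adding c′·x^(K+1)
  -- back to an antiderivative of the difference gives one of p.
  antidifference-step : ∀ k p → Deg≤ p (suc k) → (∀ r → Deg≤ r k → Antidifference k r) →
    ∀ c′ → c′ * toℚ (suc (suc k)) ≡ coeff p (suc k) → Antidifference (suc k) p
  antidifference-step k p dp lower c′ c′-top = record
    { prim      = P
    ; prim-deg  = deg-⊕ {mono c′ (suc K)} {P′} (deg-mono c′ (suc K)) (deg-weaken {P′} (ℕP.n≤1+n K) prim-deg)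
    ; prim-step = step
    ; prim-zero = zero-value
    ; prim-top  = trans (cong (_* toℚ (suc K)) top) c′-top
    }
    where
    K = suc k
    r : Poly
    r = p ⊕ (scale (- c′) (binomial (suc K)) ⊕ scale c′ (mono 1ℚ (suc K)))
    coeff-r : ∀ i → coeff r i ≡ coeff p i + (- c′ * coeff (binomial (suc K)) i + c′ * coeff (mono 1ℚ (suc K)) i)
    coeff-r i rewrite coeff-⊕ p (scale (- c′) (binomial (suc K)) ⊕ scale c′ (mono 1ℚ (suc K))) i
      | coeff-⊕ (scale (- c′) (binomial (suc K))) (scale c′ (mono 1ℚ (suc K))) i
      | coeff-scale (- c′) (binomial (suc K)) i | coeff-scale c′ (mono 1ℚ (suc K)) i = refl
    -- at x^K the top coefficient of p cancels against c′·(K+1); at x^(K+1)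
    -- the leading terms of (1+x)^(K+1) and x^(K+1) cancel
    deg-r : Deg≤ r k
    deg-r i lt with ℕP.m≤n⇒m<n∨m≡n lt
    ... | inj₂ refl rewrite coeff-r K | coeff-binomial-next K | coeff-mono-below 1ℚ (suc K) K (ℕP.n<1+n K) =
      trans (cong (_+ (- c′ * toℚ (suc K) + c′ * 0ℚ)) (sym c′-top))
        (solve 2 (λ a b → a :* b :+ (:- a :* b :+ a :* con 0ℚ) := con 0ℚ) refl c′ (toℚ (suc K)))
    ... | inj₁ K<i with ℕP.m≤n⇒m<n∨m≡n K<i
    ...   | inj₂ refl rewrite coeff-r (suc K) | dp (suc K) (ℕP.n<1+n K) | coeff-binomial-top (suc K)
            | coeff-mono-top 1ℚ (suc K) =
      solve 1 (λ a → con 0ℚ :+ (:- a :* con 1ℚ :+ a :* con 1ℚ) := con 0ℚ) refl c′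
    ...   | inj₁ K+1<i rewrite coeff-r i | dp i (ℕP.<-trans (ℕP.n<1+n K) K+1<i)
            | deg-binomial (suc K) i K+1<i | deg-mono 1ℚ (suc K) i K+1<i =
      solve 1 (λ a → con 0ℚ :+ (:- a :* con 0ℚ :+ a :* con 0ℚ) := con 0ℚ) refl c′
    open Antidifference (lower r deg-r)
    P′ = prim
    P  = mono c′ (suc K) ⊕ P′
    -- P(x+1) − P(x) = c′((1+x)^(K+1) − x^(K+1)) + r(x) = p(x)
    step : ∀ x → eval P (1ℚ + x) ≡ eval P x + eval p x
    step x rewrite eval-⊕ (mono c′ (suc K)) P′ (1ℚ + x) | eval-⊕ (mono c′ (suc K)) P′ x
      | eval-mono c′ (suc K) (1ℚ + x) | eval-mono c′ (suc K) x | prim-step x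
      | eval-⊕ p (scale (- c′) (binomial (suc K)) ⊕ scale c′ (mono 1ℚ (suc K))) x
      | eval-⊕ (scale (- c′) (binomial (suc K))) (scale c′ (mono 1ℚ (suc K))) x
      | eval-scale (- c′) (binomial (suc K)) x | eval-scale c′ (mono 1ℚ (suc K)) x
      | eval-binomial (suc K) x | eval-mono 1ℚ (suc K) x =
      solve 5 (λ a A B Q q → a :* A :+ (Q :+ (q :+ (:- a :* A :+ a :* (con 1ℚ :* B))))
                           := (a :* B :+ Q) :+ q)
        refl c′ ((1ℚ + x) ^ℚ suc K) (x ^ℚ suc K) (eval P′ x) (eval p x)
    zero-value : eval P 0ℚ ≡ 0ℚ
    zero-value rewrite eval-⊕ (mono c′ (suc K)) P′ 0ℚ | eval-mono c′ (suc K) 0ℚ | prim-zero =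
      solve 2 (λ a b → a :* (con 0ℚ :* b) :+ con 0ℚ := con 0ℚ) refl c′ (0ℚ ^ℚ K)
    top : coeff P (suc K) ≡ c′
    top rewrite coeff-⊕ (mono c′ (suc K)) P′ (suc K) | coeff-mono-top c′ (suc K)
      | prim-deg (suc K) (ℕP.n<1+n K) = +-identityʳ c′

  antidifference : ∀ k p → Deg≤ p k → Antidifference k p
  antidifference zero p dp = record
    { prim      = 0ℚ ∷ c ∷ []
    ; prim-deg  = deg-linear 0ℚ c
    ; prim-step = λ x → trans (step x) (cong (eval (0ℚ ∷ c ∷ []) x +_) (sym (eval-deg0 p dp x)))
    ; prim-zero = solve 1 (λ c → con 0ℚ :+ con 0ℚ :* (c :+ con 0ℚ :* con 0ℚ) := con 0ℚ) refl c
    ; prim-top  = *-identityʳ c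
    }
    where
    c = coeff p 0
    step : ∀ x → eval (0ℚ ∷ c ∷ []) (1ℚ + x) ≡ eval (0ℚ ∷ c ∷ []) x + c
    step x = solve 2 (λ c x → con 0ℚ :+ (con 1ℚ :+ x) :* (c :+ (con 1ℚ :+ x) :* con 0ℚ)
                          := (con 0ℚ :+ x :* (c :+ x :* con 0ℚ)) :+ c) refl c x
  antidifference (suc k) p dp =
    antidifference-step k p dp (antidifference k) (coeff p (suc k) * recip (suc k)) (recip-cancel (suc k) (coeff p (suc k)))

module FiniteSums where

  open import Data.Bool using (Bool; true; false; if_then_else_)
  open import Data.Nat using (ℕ; zero; suc; _+_; _*_)
  import Data.Nat.Properties as ℕP
  open import Data.List using (List; []; _∷_; map; concatMap; filter; _++_)
  open import Data.List.Membership.Propositional using (_∈_)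
  open import Data.List.Membership.Propositional.Properties using (∈-map⁺; ∈-concatMap⁺)
  import Data.List.Relation.Unary.Any as Any
  open import Data.Vec using (Vec; []; _∷_)
  open import Data.Nat.ListAction using (sum)
  open import Data.Bool.Properties using () renaming (_≟_ to _≟B_)
  open import Function using (_∘_)
  open import Relation.Binary.PropositionalEquality
  open import Data.Nat.Solver using (module +-*-Solver)
  open +-*-Solver
  open import Defs using (allVecs)

  ΣL : {X : Set} → List X → (X → ℕ) → ℕ
  ΣL L f = sum (map f L)

  ΣL-cong : {X : Set} (L : List X) {f g : X → ℕ} → (∀ x → f x ≡ g x) → ΣL L f ≡ ΣL L g
  ΣL-cong []      eq = refl
  ΣL-cong (x ∷ L) eq = cong₂ _+_ (eq x) (ΣL-cong L eq)

  ΣL-zero : {X : Set} (L : List X) → ΣL L (λ _ → 0) ≡ 0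
  ΣL-zero []      = refl
  ΣL-zero (x ∷ L) = ΣL-zero L

  ΣL-++ : {X : Set} (L₁ L₂ : List X) (f : X → ℕ) → ΣL (L₁ ++ L₂) f ≡ ΣL L₁ f + ΣL L₂ f
  ΣL-++ []       L₂ f = refl
  ΣL-++ (x ∷ L₁) L₂ f = trans (cong (f x +_) (ΣL-++ L₁ L₂ f)) (sym (ℕP.+-assoc (f x) _ _))

  ΣL-concatMap : {X Y : Set} (g : X → List Y) (L : List X) (f : Y → ℕ) →
    ΣL (concatMap g L) f ≡ ΣL L (λ x → ΣL (g x) f)
  ΣL-concatMap g []      f = refl
  ΣL-concatMap g (x ∷ L) f =
    trans (ΣL-++ (g x) (concatMap g L) f) (cong (ΣL (g x) f +_) (ΣL-concatMap g L f))

  ΣL-map : {X Y : Set} (h : X → Y) (L : List X) (f : Y → ℕ) → ΣL (map h L) f ≡ ΣL L (f ∘ h)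
  ΣL-map h []      f = refl
  ΣL-map h (x ∷ L) f = cong (f (h x) +_) (ΣL-map h L f)

  ΣL-+ : {X : Set} (L : List X) (f g : X → ℕ) → ΣL L (λ x → f x + g x) ≡ ΣL L f + ΣL L g
  ΣL-+ []      f g = refl
  ΣL-+ (x ∷ L) f g rewrite ΣL-+ L f g =
    solve 4 (λ a b c e → (a :+ b) :+ (c :+ e) := (a :+ c) :+ (b :+ e)) refl (f x) (g x) (ΣL L f) (ΣL L g)

  ΣL-*ˡ : {X : Set} (L : List X) (c : ℕ) (f : X → ℕ) → ΣL L (λ x → c * f x) ≡ c * ΣL L f
  ΣL-*ˡ []      c f = sym (ℕP.*-zeroʳ c)
  ΣL-*ˡ (x ∷ L) c f rewrite ΣL-*ˡ L c f = sym (ℕP.*-distribˡ-+ c (f x) (ΣL L f))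

  ΣL-*ʳ : {X : Set} (L : List X) (c : ℕ) (f : X → ℕ) → ΣL L (λ x → f x * c) ≡ ΣL L f * c
  ΣL-*ʳ []      c f = refl
  ΣL-*ʳ (x ∷ L) c f rewrite ΣL-*ʳ L c f = sym (ℕP.*-distribʳ-+ c (f x) (ΣL L f))

  ΣL-swap : {X Y : Set} (L₁ : List X) (L₂ : List Y) (f : X → Y → ℕ) →
    ΣL L₁ (λ x → ΣL L₂ (f x)) ≡ ΣL L₂ (λ y → ΣL L₁ (λ x → f x y))
  ΣL-swap []       L₂ f = sym (ΣL-zero L₂)
  ΣL-swap (x ∷ L₁) L₂ f rewrite ΣL-swap L₁ L₂ f = sym (ΣL-+ L₂ (f x) (λ y → ΣL L₁ (λ x → f x y)))

  ΣL-filter : {X : Set} (P : X → Bool) (f : X → ℕ) (L : List X) →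
    ΣL (filter (λ x → P x ≟B true) L) f ≡ ΣL L (λ x → if P x then f x else 0)
  ΣL-filter P f []      = refl
  ΣL-filter P f (x ∷ L) with P x
  ... | true  = cong (f x +_) (ΣL-filter P f L)
  ... | false = ΣL-filter P f L

  Σ< : ℕ → (ℕ → ℕ) → ℕ
  Σ< zero    f = 0
  Σ< (suc d) f = f 0 + Σ< d (f ∘ suc)

  Σ<-cong : ∀ d {f g : ℕ → ℕ} → (∀ h → f h ≡ g h) → Σ< d f ≡ Σ< d g
  Σ<-cong zero    eq = refl
  Σ<-cong (suc d) eq = cong₂ _+_ (eq 0) (Σ<-cong d (eq ∘ suc))

  Σ<-zero : ∀ d → Σ< d (λ _ → 0) ≡ 0
  Σ<-zero zero    = refl
  Σ<-zero (suc d) = Σ<-zero d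

  Σ<-snoc : ∀ d (f : ℕ → ℕ) → Σ< (suc d) f ≡ Σ< d f + f d
  Σ<-snoc zero    f = ℕP.+-identityʳ (f 0)
  Σ<-snoc (suc d) f rewrite Σ<-snoc d (f ∘ suc) = sym (ℕP.+-assoc (f 0) (Σ< d (f ∘ suc)) (f (suc d)))

  Σ<-ΣL : {X : Set} (d : ℕ) (L : List X) (f : ℕ → X → ℕ) →
    Σ< d (λ h → ΣL L (f h)) ≡ ΣL L (λ x → Σ< d (λ h → f h x))
  Σ<-ΣL zero    L f = sym (ΣL-zero L)
  Σ<-ΣL (suc d) L f rewrite Σ<-ΣL d L (f ∘ suc) = sym (ΣL-+ L (f 0) (λ x → Σ< d (λ h → f (suc h) x)))

  Σ<-*ʳ : ∀ d (f : ℕ → ℕ) c → Σ< d (λ h → f h * c) ≡ Σ< d f * c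
  Σ<-*ʳ zero    f c = refl
  Σ<-*ʳ (suc d) f c rewrite Σ<-*ʳ d (f ∘ suc) c = sym (ℕP.*-distribʳ-+ c (f 0) (Σ< d (f ∘ suc)))

  ⋃< : {X : Set} → ℕ → (ℕ → List X) → List X
  ⋃< zero    g = []
  ⋃< (suc d) g = g 0 ++ ⋃< d (g ∘ suc)

  ΣL-⋃< : {X : Set} (d : ℕ) (g : ℕ → List X) (f : X → ℕ) → ΣL (⋃< d g) f ≡ Σ< d (λ h → ΣL (g h) f)
  ΣL-⋃< zero    g f = refl
  ΣL-⋃< (suc d) g f = trans (ΣL-++ (g 0) (⋃< d (g ∘ suc)) f) (cong (ΣL (g 0) f +_) (ΣL-⋃< d (g ∘ suc) f))

  ΣL-allVecs-suc : {X : Set} (xs : List X) (k : ℕ) (f : Vec X (suc k) → ℕ) →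
    ΣL (allVecs xs (suc k)) f ≡ ΣL xs (λ x → ΣL (allVecs xs k) (λ v → f (x ∷ v)))
  ΣL-allVecs-suc xs k f = trans (ΣL-concatMap (λ x → map (x ∷_) (allVecs xs k)) xs f)
    (ΣL-cong xs (λ x → ΣL-map (x ∷_) (allVecs xs k) f))

  ∈-allVecs : {X : Set} {xs : List X} → (∀ x → x ∈ xs) → ∀ {k} (v : Vec X k) → v ∈ allVecs xs k
  ∈-allVecs all []      = Any.here refl
  ∈-allVecs {xs = xs} all (x ∷ v) =
    ∈-concatMap⁺ (λ y → map (y ∷_) (allVecs xs _)) (Any.map (λ { refl → ∈-map⁺ (x ∷_) (∈-allVecs all v) }) (all x))

module PolynomialFunctions where

  open import Data.Nat as ℕ using (ℕ; zero; suc; s≤s)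
  import Data.Nat.Properties as ℕP
  open import Data.List using (List; []; _∷_)
  open import Data.List.Membership.Propositional using (_∈_)
  open import Data.List.Relation.Unary.Any using (here; there)
  open import Data.Vec using (Vec; []; _∷_)
  import Data.Vec as Vec
  open import Data.Product using (Σ; _,_; proj₁; proj₂)
  open import Data.Sum using (inj₁; inj₂)
  open import Relation.Nullary using (¬_)
  open import Relation.Binary.PropositionalEquality
  open import Data.Rational
  open import Data.Rational.Properties
  open import Data.Rational.Solver using (module +-*-Solver)
  open +-*-Solver using (solve; _:=_; _:+_; _:*_; con)
  open import Defs using (toℚ; evalPoly; IsPolyOfDegree)
  open RationalPolynomials
  open FiniteSums using (ΣL; Σ<; Σ<-snoc)

  record PolyRep (f : ℕ → ℕ) (D : ℕ) : Set where
    constructor polyRep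
    field
      poly    : Poly
      agrees  : ∀ d → toℚ (f d) ≡ eval poly (toℚ d)
      bounded : Deg≤ poly D
  open PolyRep public

  lead : ∀ {f D} → PolyRep f D → ℚ
  lead {D = D} r = coeff (poly r) D

  -- Non-negativity is what keeps leading
  -- terms from cancelling when such functions are added.
  NonNegLead : (ℕ → ℕ) → ℕ → Set
  NonNegLead f D = Σ (PolyRep f D) λ r → NonNegative (lead r)

  PosLead : (ℕ → ℕ) → ℕ → Set
  PosLead f D = Σ (PolyRep f D) λ r → Positive (lead r)

  pos⇒nonNegLead : ∀ {f D} → PosLead f D → NonNegLead f D
  pos⇒nonNegLead (r , p) = r , pos⇒nonNeg (lead r) {{p}}

  polyRep-ext : ∀ {f g D} → (∀ d → f d ≡ g d) → PolyRep f D → PolyRep g D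
  polyRep-ext eq (polyRep p e dp) = polyRep p (λ d → trans (cong toℚ (sym (eq d))) (e d)) dp

  nonNegLead-ext : ∀ {f g D} → (∀ d → f d ≡ g d) → NonNegLead f D → NonNegLead g D
  nonNegLead-ext eq (r , s) = polyRep-ext eq r , s

  posLead-ext : ∀ {f g D} → (∀ d → f d ≡ g d) → PosLead f D → PosLead g D
  posLead-ext eq (r , s) = polyRep-ext eq r , s

  -- raising the degree bound leaves a zero (hence non-negative) top coefficient
  nonNegLead-weaken : ∀ {f D D′} → D ℕ.≤ D′ → NonNegLead f D → NonNegLead f D′
  nonNegLead-weaken {D = D} {D′} D≤D′ (polyRep p e dp , s) with ℕP.m≤n⇒m<n∨m≡n D≤D′
  ... | inj₂ refl = polyRep p e dp , s
  ... | inj₁ D<D′ = polyRep p e (deg-weaken {p} D≤D′ dp) , subst NonNegative (sym (dp D′ D<D′)) (toℚ-nonNeg 0)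

  const-rep : ∀ k → PolyRep (λ _ → k) 0
  const-rep k = polyRep (toℚ k ∷ []) (λ d → solve 2 (λ c x → c := c :+ x :* con 0ℚ) refl (toℚ k) (toℚ d))
                        (deg-const (toℚ k))

  const-nonNegLead : ∀ k → NonNegLead (λ _ → k) 0
  const-nonNegLead k = const-rep k , toℚ-nonNeg k

  const-posLead : ∀ k → PosLead (λ _ → suc k) 0
  const-posLead k = const-rep (suc k) , toℚ-pos k

  zero-nonNegLead : ∀ D → NonNegLead (λ _ → 0) D
  zero-nonNegLead D = polyRep [] (λ d → refl) (λ _ _ → refl) , toℚ-nonNeg 0

  id-posLead : PosLead (λ d → d) 1
  id-posLead = polyRep (0ℚ ∷ 1ℚ ∷ [])
    (λ d → solve 1 (λ x → x := con 0ℚ :+ x :* (con 1ℚ :+ x :* con 0ℚ)) refl (toℚ d))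
    (deg-linear 0ℚ 1ℚ) , toℚ-pos 0

  suc-posLead : PosLead suc 1
  suc-posLead = polyRep (1ℚ ∷ 1ℚ ∷ [])
    (λ d → trans (toℚ-+ 1 d) (solve 1 (λ x → con 1ℚ :+ x := con 1ℚ :+ x :* (con 1ℚ :+ x :* con 0ℚ)) refl (toℚ d)))
    (deg-linear 1ℚ 1ℚ) , toℚ-pos 0

  +-rep : ∀ {f g D} → (r : PolyRep f D) (s : PolyRep g D) →
    Σ (PolyRep (λ d → f d ℕ.+ g d) D) λ t → lead t ≡ lead r + lead s
  +-rep {f} {g} {D} (polyRep p e dp) (polyRep q e′ dq) =
    polyRep (p ⊕ q) (λ d → trans (toℚ-+ (f d) (g d)) (trans (cong₂ _+_ (e d) (e′ d)) (sym (eval-⊕ p q (toℚ d)))))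
                    (deg-⊕ {p} {q} dp dq)
    , coeff-⊕ p q D

  +-nonNegLead : ∀ {f g D} → NonNegLead f D → NonNegLead g D → NonNegLead (λ d → f d ℕ.+ g d) D
  +-nonNegLead (r , a) (s , b) with +-rep r s
  ... | t , eq = t , subst NonNegative (sym eq) (nonNeg+nonNeg⇒nonNeg (lead r) {{a}} (lead s) {{b}})

  pos+nonNeg-lead : ∀ {f g D} → PosLead f D → NonNegLead g D → PosLead (λ d → f d ℕ.+ g d) D
  pos+nonNeg-lead (r , a) (s , b) with +-rep r s
  ... | t , eq = t , subst Positive (trans (+-comm (lead s) (lead r)) (sym eq))
                                     (nonNeg+pos⇒pos (lead s) {{b}} (lead r) {{a}})

  nonNeg+pos-lead : ∀ {f g D} → NonNegLead f D → PosLead g D → PosLead (λ d → f d ℕ.+ g d) D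
  nonNeg+pos-lead (r , a) (s , b) with +-rep r s
  ... | t , eq = t , subst Positive (sym eq) (nonNeg+pos⇒pos (lead r) {{a}} (lead s) {{b}})

  *-rep : ∀ {f g A B} → (r : PolyRep f A) (s : PolyRep g B) →
    Σ (PolyRep (λ d → f d ℕ.* g d) (A ℕ.+ B)) λ t → lead t ≡ lead r * lead s
  *-rep {f} {g} {A} {B} (polyRep p e dp) (polyRep q e′ dq) =
    polyRep (p ⊗ q) (λ d → trans (toℚ-* (f d) (g d)) (trans (cong₂ _*_ (e d) (e′ d)) (sym (eval-⊗ p q (toℚ d)))))
                    (proj₁ (deg-⊗ p q A B dp dq))
    , proj₂ (deg-⊗ p q A B dp dq)

  *-nonNegLead : ∀ {f g A B} → NonNegLead f A → NonNegLead g B → NonNegLead (λ d → f d ℕ.* g d) (A ℕ.+ B)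
  *-nonNegLead (r , a) (s , b) with *-rep r s
  ... | t , eq = t , subst NonNegative (sym eq) (nonNeg*nonNeg⇒nonNeg (lead r) {{a}} (lead s) {{b}})

  *-posLead : ∀ {f g A B} → PosLead f A → PosLead g B → PosLead (λ d → f d ℕ.* g d) (A ℕ.+ B)
  *-posLead (r , a) (s , b) with *-rep r s
  ... | t , eq = t , subst Positive (sym eq) (pos*pos⇒pos (lead r) {{a}} (lead s) {{b}})

  ^-posLead : ∀ {f D} → PosLead f D → ∀ e → PosLead (λ d → f d ℕ.^ e) (e ℕ.* D)
  ^-posLead pf zero    = const-posLead 0
  ^-posLead pf (suc e) = *-posLead pf (^-posLead pf e)

  Σ<-rep : ∀ {f D} → (r : PolyRep f D) →
    Σ (PolyRep (λ d → Σ< d f) (suc D)) λ t → lead t ≡ lead r * recip D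
  Σ<-rep {f} {D} (polyRep p e dp) = polyRep prim agrees-Σ prim-deg , recip-solve D (coeff prim (suc D)) (coeff p D) prim-top
    where
    open Antidifference (antidifference D p dp)
    agrees-Σ : ∀ d → toℚ (Σ< d f) ≡ eval prim (toℚ d)
    agrees-Σ zero    = sym prim-zero
    agrees-Σ (suc d) = begin
      toℚ (Σ< (suc d) f)                  ≡⟨ cong toℚ (Σ<-snoc d f) ⟩
      toℚ (Σ< d f ℕ.+ f d)                ≡⟨ toℚ-+ (Σ< d f) (f d) ⟩
      toℚ (Σ< d f) + toℚ (f d)            ≡⟨ cong₂ _+_ (agrees-Σ d) (e d) ⟩
      eval prim (toℚ d) + eval p (toℚ d)  ≡⟨ sym (prim-step (toℚ d)) ⟩
      eval prim (1ℚ + toℚ d)              ≡⟨ cong (eval prim) (sym (toℚ-+ 1 d)) ⟩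
      eval prim (toℚ (suc d))             ∎
      where open ≡-Reasoning

  Σ<-posLead : ∀ {f D} → PosLead f D → PosLead (λ d → Σ< d f) (suc D)
  Σ<-posLead {D = D} (r , a) with Σ<-rep r
  ... | t , eq = t , subst Positive (sym eq) (pos*pos⇒pos (lead r) {{a}} (recip D) {{recip-pos D}})

  ΣL-nonNegLead : ∀ {X : Set} {D} (L : List X) (F : X → ℕ → ℕ) → (∀ x → NonNegLead (F x) D) →
    NonNegLead (λ d → ΣL L (λ x → F x d)) D
  ΣL-nonNegLead {D = D} []      F nn = zero-nonNegLead D
  ΣL-nonNegLead         (x ∷ L) F nn = +-nonNegLead (nn x) (ΣL-nonNegLead L F nn)

  ΣL-posLead : ∀ {X : Set} {D} {L : List X} (F : X → ℕ → ℕ) {x} → x ∈ L →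
    PosLead (F x) D → (∀ y → NonNegLead (F y) D) → PosLead (λ d → ΣL L (λ y → F y d)) D
  ΣL-posLead {L = _ ∷ L} F (here refl) px nn = pos+nonNeg-lead px (ΣL-nonNegLead L F nn)
  ΣL-posLead {L = y ∷ L} F (there x∈L) px nn = nonNeg+pos-lead (nn y) (ΣL-posLead F x∈L px nn)

  dropCoeff : Poly → Poly
  dropCoeff []      = []
  dropCoeff (c ∷ p) = p

  coeff-dropCoeff : ∀ p i → coeff (dropCoeff p) i ≡ coeff p (suc i)
  coeff-dropCoeff []      i = refl
  coeff-dropCoeff (c ∷ p) i = refl

  coeffVec : Poly → (D : ℕ) → Vec ℚ (suc D)
  coeffVec p zero    = coeff p 0 ∷ []
  coeffVec p (suc D) = coeff p 0 ∷ coeffVec (dropCoeff p) D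

  eval-dropCoeff : ∀ p x → eval p x ≡ coeff p 0 + x * eval (dropCoeff p) x
  eval-dropCoeff []      x = solve 1 (λ x → con 0ℚ := con 0ℚ :+ x :* con 0ℚ) refl x
  eval-dropCoeff (c ∷ p) x = refl

  evalPoly-coeffVec : ∀ p D → Deg≤ p D → ∀ x → evalPoly (coeffVec p D) x ≡ eval p x
  evalPoly-coeffVec p zero dp x =
    trans (solve 2 (λ c x → c :+ x :* con 0ℚ := c) refl (coeff p 0) x) (sym (eval-deg0 p dp x))
  evalPoly-coeffVec p (suc D) dp x =
    trans (cong (λ z → coeff p 0 + x * z)
                (evalPoly-coeffVec (dropCoeff p) D (λ i lt → trans (coeff-dropCoeff p i) (dp (suc i) (s≤s lt))) x))
          (sym (eval-dropCoeff p x))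

  last-coeffVec : ∀ p D → Vec.last (coeffVec p D) ≡ coeff p D
  last-coeffVec p zero    = refl
  last-coeffVec p (suc D) = trans (last-coeffVec (dropCoeff p) D) (coeff-dropCoeff p D)

  posLead⇒isPolyOfDegree : ∀ {f D} → PosLead f D → IsPolyOfDegree f D
  posLead⇒isPolyOfDegree {f} {D} (polyRep p e dp , pos) =
    coeffVec p D , last≢0 , λ d _ → trans (e d) (sym (evalPoly-coeffVec p D dp (toℚ d)))
    where
    last≢0 : ¬ (Vec.last (coeffVec p D) ≡ 0ℚ)
    last≢0 eq = <-irrefl refl (subst (0ℚ <_) (trans (sym (last-coeffVec p D)) eq) (positive⁻¹ _ {{pos}}))

module Columns where

  open import Data.Bool using (Bool; true; false; _∧_; _∨_; not; if_then_else_)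
  import Data.Bool.Properties as BoolP
  open import Data.Nat using (ℕ; zero; suc; _+_)
  import Data.Nat.Properties as ℕP
  open import Data.Fin using (Fin; toℕ) renaming (zero to fzero; suc to fsuc)
  open import Data.Vec using (Vec; []; _∷_; lookup; replicate; transpose; _⊛_)
  import Data.Vec as Vec
  open import Data.List using (List; []; _∷_; [_]; map; allFin; tabulate)
  import Data.List.Properties as ListP
  open import Data.Nat.ListAction using (sum)
  open import Function using (_∘_)
  open import Relation.Binary.PropositionalEquality hiding ([_])
  open import Data.Nat.Solver using (module +-*-Solver)
  open +-*-Solver
  open import Defs
  open FiniteSums

  -- Reading a subset of A_{d,n} by columns: the matrix M with rows r₁,…,r_d
  -- is transpose C for the list C of its n columns.

  bools : List Bool
  bools = true ∷ false ∷ []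

  -- prepend a column to a list of rows: this is the recursive step of transpose
  _∷ᶜ_ : {X : Set} {d n : ℕ} → Vec X d → Vec (Vec X n) d → Vec (Vec X (suc n)) d
  c ∷ᶜ M = (replicate _ _∷_ ⊛ c) ⊛ M

  lookup-∷ᶜ : {X : Set} {d n : ℕ} (c : Vec X d) (M : Vec (Vec X n) d) (i : Fin d) →
    lookup (c ∷ᶜ M) i ≡ lookup c i ∷ lookup M i
  lookup-∷ᶜ (x ∷ c) (r ∷ M) fzero    = refl
  lookup-∷ᶜ (x ∷ c) (r ∷ M) (fsuc i) = lookup-∷ᶜ c M i

  ΣL-allVecs-single : {X : Set} (y : X) (d : ℕ) (g : Vec X d → ℕ) → ΣL (allVecs [ y ] d) g ≡ g (replicate d y)
  ΣL-allVecs-single y zero    g = ℕP.+-identityʳ _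
  ΣL-allVecs-single y (suc d) g =
    trans (ΣL-allVecs-suc [ y ] d g) (trans (ℕP.+-identityʳ _) (ΣL-allVecs-single y d (g ∘ (y ∷_))))

  ΣL-matrices-column : {X : Set} (xs : List X) (n d : ℕ) (g : Vec (Vec X (suc n)) d → ℕ) →
    ΣL (allVecs xs d) (λ c → ΣL (allVecs (allVecs xs n) d) (λ M → g (c ∷ᶜ M)))
    ≡ ΣL (allVecs (allVecs xs (suc n)) d) g
  ΣL-matrices-column xs n zero    g = ℕP.+-identityʳ _
  ΣL-matrices-column xs n (suc d) g = begin
    ΣL (allVecs xs (suc d)) (λ c → ΣL (allVecs Rows (suc d)) (λ M → g (c ∷ᶜ M)))
      ≡⟨ ΣL-allVecs-suc xs d _ ⟩
    ΣL xs (λ x → ΣL (allVecs xs d) (λ c → ΣL (allVecs Rows (suc d)) (λ M → g ((x ∷ c) ∷ᶜ M))))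
      ≡⟨ ΣL-cong xs (λ x → ΣL-cong (allVecs xs d) (λ c → ΣL-allVecs-suc Rows d _)) ⟩
    ΣL xs (λ x → ΣL (allVecs xs d) (λ c → ΣL Rows (λ r → ΣL (allVecs Rows d) (λ M → g ((x ∷ r) ∷ (c ∷ᶜ M))))))
      ≡⟨ ΣL-cong xs (λ x → ΣL-swap (allVecs xs d) Rows _) ⟩
    ΣL xs (λ x → ΣL Rows (λ r → ΣL (allVecs xs d) (λ c → ΣL (allVecs Rows d) (λ M → g ((x ∷ r) ∷ (c ∷ᶜ M))))))
      ≡⟨ ΣL-cong xs (λ x → ΣL-cong Rows (λ r → ΣL-matrices-column xs n d (g ∘ ((x ∷ r) ∷_)))) ⟩
    ΣL xs (λ x → ΣL Rows (λ r → ΣL (allVecs (allVecs xs (suc n)) d) (λ N → g ((x ∷ r) ∷ N))))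
      ≡⟨ sym (ΣL-allVecs-suc xs n _) ⟩
    ΣL (allVecs xs (suc n)) (λ row → ΣL (allVecs (allVecs xs (suc n)) d) (λ N → g (row ∷ N)))
      ≡⟨ sym (ΣL-allVecs-suc (allVecs xs (suc n)) d g) ⟩
    ΣL (allVecs (allVecs xs (suc n)) (suc d)) g ∎
    where
    open ≡-Reasoning
    Rows = allVecs xs n

  ΣL-transpose : {X : Set} (xs : List X) (n d : ℕ) (g : Vec (Vec X n) d → ℕ) →
    ΣL (allVecs (allVecs xs n) d) g ≡ ΣL (allVecs (allVecs xs d) n) (g ∘ transpose)
  ΣL-transpose xs zero    d g = trans (ΣL-allVecs-single [] d g) (sym (ℕP.+-identityʳ _))
  ΣL-transpose xs (suc n) d g = sym (begin
    ΣL (allVecs (allVecs xs d) (suc n)) (g ∘ transpose)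
      ≡⟨ ΣL-allVecs-suc (allVecs xs d) n _ ⟩
    ΣL (allVecs xs d) (λ c → ΣL (allVecs (allVecs xs d) n) (λ C → g (c ∷ᶜ transpose C)))
      ≡⟨ ΣL-cong (allVecs xs d) (λ c → sym (ΣL-transpose xs n d (g ∘ (c ∷ᶜ_)))) ⟩
    ΣL (allVecs xs d) (λ c → ΣL (allVecs (allVecs xs n) d) (λ M → g (c ∷ᶜ M)))
      ≡⟨ ΣL-matrices-column xs n d g ⟩
    ΣL (allVecs (allVecs xs (suc n)) d) g ∎)
    where open ≡-Reasoning

  -- Niceness in terms of columns.  Condition (1) says every column is an
  -- initial segment {1,…,h} of rows; condition (2) says no two adjacent
  -- columns both contain their top cell.

  isPrefix : {d : ℕ} → Vec Bool d → Bool
  isPrefix []          = true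
  isPrefix (x ∷ [])    = true
  isPrefix (x ∷ y ∷ c) = (y ⇒ᵇ x) ∧ isPrefix (y ∷ c)

  topCell : {d : ℕ} → Vec Bool d → Bool
  topCell []      = false
  topCell (x ∷ _) = x

  allPrefix : {d n : ℕ} → Vec (Vec Bool d) n → Bool
  allPrefix []      = true
  allPrefix (c ∷ C) = isPrefix c ∧ allPrefix C

  -- no two adjacent trues; `free` says whether the first entry may be true
  noAdjacentFrom : {n : ℕ} → (free : Bool) → Vec Bool n → Bool
  noAdjacentFrom free []      = true
  noAdjacentFrom free (x ∷ v) = (free ∨ not x) ∧ noAdjacentFrom (not x) v

  -- nice column lists; `free` says whether the first column may use its top cell
  niceCols : {d n : ℕ} → (free : Bool) → Vec (Vec Bool d) n → Bool
  niceCols free []      = true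
  niceCols free (c ∷ C) = isPrefix c ∧ ((free ∨ not (topCell c)) ∧ niceCols (not (topCell c)) C)

  ∧-interchange : ∀ p q r s → (p ∧ q) ∧ (r ∧ s) ≡ (p ∧ r) ∧ (q ∧ s)
  ∧-interchange true  true  r s = refl
  ∧-interchange true  false r s = sym (BoolP.∧-zeroʳ r)
  ∧-interchange false q     r s = refl

  downClosed-∷ᶜ : ∀ {d n} (c : Vec Bool d) (M : Vec (Vec Bool n) d) →
    downClosed (c ∷ᶜ M) ≡ isPrefix c ∧ downClosed M
  downClosed-∷ᶜ []          []          = refl
  downClosed-∷ᶜ (x ∷ [])    (r ∷ [])    = refl
  downClosed-∷ᶜ (x ∷ y ∷ c) (r ∷ s ∷ M) =
    trans (cong (allᵇ (Vec.zipWith _⇒ᵇ_ (y ∷ s) (x ∷ r)) ∧_) (downClosed-∷ᶜ (y ∷ c) (s ∷ M)))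
          (∧-interchange (y ⇒ᵇ x) (allᵇ (Vec.zipWith _⇒ᵇ_ s r)) (isPrefix (y ∷ c)) (downClosed (s ∷ M)))

  downClosed-empty-rows : ∀ d → downClosed (replicate {A = Vec Bool 0} d []) ≡ true
  downClosed-empty-rows zero          = refl
  downClosed-empty-rows (suc zero)    = refl
  downClosed-empty-rows (suc (suc d)) = downClosed-empty-rows (suc d)

  downClosed-transpose : ∀ {d n} (C : Vec (Vec Bool d) n) → downClosed (transpose C) ≡ allPrefix C
  downClosed-transpose {d} []      = downClosed-empty-rows d
  downClosed-transpose     (c ∷ C) = trans (downClosed-∷ᶜ c (transpose C)) (cong (isPrefix c ∧_) (downClosed-transpose C))

  transpose-topRow : ∀ {d n} (C : Vec (Vec Bool (suc d)) n) →
    transpose C ≡ Vec.map topCell C ∷ transpose (Vec.map Vec.tail C)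
  transpose-topRow []            = refl
  transpose-topRow ((x ∷ c) ∷ C) rewrite transpose-topRow C = refl

  firstRowOK-no-rows : ∀ {n} (M : Vec (Vec Bool n) 0) → firstRowOK M ≡ true
  firstRowOK-no-rows [] = refl

  noAdjacent-empty-columns : ∀ {n} (C : Vec (Vec Bool 0) n) → noAdjacent (Vec.map topCell C) ≡ true
  noAdjacent-empty-columns []            = refl
  noAdjacent-empty-columns ([] ∷ [])     = refl
  noAdjacent-empty-columns ([] ∷ [] ∷ C) = noAdjacent-empty-columns ([] ∷ C)

  firstRowOK-transpose : ∀ {d n} (C : Vec (Vec Bool d) n) →
    firstRowOK (transpose C) ≡ noAdjacent (Vec.map topCell C)
  firstRowOK-transpose {zero}  C = trans (firstRowOK-no-rows (transpose C)) (sym (noAdjacent-empty-columns C))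
  firstRowOK-transpose {suc d} C rewrite transpose-topRow C = refl

  not-∧ : ∀ x y → not (x ∧ y) ≡ (not x ∨ not y)
  not-∧ true  y = refl
  not-∧ false y = refl

  noAdjacent-cons : ∀ {n} x (v : Vec Bool n) → noAdjacent (x ∷ v) ≡ noAdjacentFrom (not x) v
  noAdjacent-cons x []      = refl
  noAdjacent-cons x (y ∷ v) = cong₂ _∧_ (not-∧ x y) (noAdjacent-cons y v)

  noAdjacent≡noAdjacentFrom : ∀ {n} (v : Vec Bool n) → noAdjacent v ≡ noAdjacentFrom true v
  noAdjacent≡noAdjacentFrom []      = refl
  noAdjacent≡noAdjacentFrom (x ∷ v) = noAdjacent-cons x v

  niceCols-split : ∀ {d n} free (C : Vec (Vec Bool d) n) →
    allPrefix C ∧ noAdjacentFrom free (Vec.map topCell C) ≡ niceCols free C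
  niceCols-split free []      = refl
  niceCols-split free (c ∷ C) = begin
    (isPrefix c ∧ allPrefix C) ∧ ((free ∨ not t) ∧ noAdjacentFrom (not t) (Vec.map topCell C))
      ≡⟨ ∧-interchange (isPrefix c) (allPrefix C) (free ∨ not t) _ ⟩
    (isPrefix c ∧ (free ∨ not t)) ∧ (allPrefix C ∧ noAdjacentFrom (not t) (Vec.map topCell C))
      ≡⟨ cong ((isPrefix c ∧ (free ∨ not t)) ∧_) (niceCols-split (not t) C) ⟩
    (isPrefix c ∧ (free ∨ not t)) ∧ niceCols (not t) C
      ≡⟨ BoolP.∧-assoc (isPrefix c) (free ∨ not t) (niceCols (not t) C) ⟩
    niceCols free (c ∷ C) ∎
    where
    open ≡-Reasoning
    t = topCell c

  nice-transpose : ∀ {d n} (C : Vec (Vec Bool d) n) → nice (transpose C) ≡ niceCols true C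
  nice-transpose C = trans
    (cong₂ _∧_ (downClosed-transpose C)
               (trans (firstRowOK-transpose C) (noAdjacent≡noAdjacentFrom (Vec.map topCell C))))
    (niceCols-split true C)

  -- Cell weights.  σ_m and |·| both have the form Σ_{(i,j) ∈ I} κ i j; read
  -- by columns this becomes a sum of column weights.

  cellWeight : {d n : ℕ} → (ℕ → ℕ → ℕ) → Subsetᴬ d n → ℕ
  cellWeight {d} {n} κ M =
    sum (map (λ i → sum (map (λ j → if mem M i j then κ (toℕ i) (toℕ j) else 0) (allFin n))) (allFin d))

  colWeight : {d : ℕ} → (ℕ → ℕ) → Vec Bool d → ℕ
  colWeight g []      = 0
  colWeight g (x ∷ c) = (if x then g 0 else 0) + colWeight (g ∘ suc) c

  colsWeight : {d n : ℕ} → (ℕ → ℕ → ℕ) → Vec (Vec Bool d) n → ℕ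
  colsWeight κ []      = 0
  colsWeight κ (c ∷ C) = colWeight (λ i → κ i 0) c + colsWeight (λ i j → κ i (suc j)) C

  colWeight-cong : ∀ {d} {g g′ : ℕ → ℕ} (c : Vec Bool d) → (∀ i → g i ≡ g′ i) → colWeight g c ≡ colWeight g′ c
  colWeight-cong []      eq = refl
  colWeight-cong (x ∷ c) eq = cong₂ _+_ (cong (λ z → if x then z else 0) (eq 0)) (colWeight-cong c (eq ∘ suc))

  colsWeight-cong : ∀ {d n} {κ κ′ : ℕ → ℕ → ℕ} (C : Vec (Vec Bool d) n) →
    (∀ i j → κ i j ≡ κ′ i j) → colsWeight κ C ≡ colsWeight κ′ C
  colsWeight-cong []      eq = refl
  colsWeight-cong (c ∷ C) eq = cong₂ _+_ (colWeight-cong c (λ i → eq i 0)) (colsWeight-cong C (λ i j → eq i (suc j)))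

  ΣFin : (n : ℕ) → (Fin n → ℕ) → ℕ
  ΣFin n h = sum (tabulate h)

  ΣL-allFin : ∀ n (h : Fin n → ℕ) → sum (map h (allFin n)) ≡ ΣFin n h
  ΣL-allFin n h = cong sum (ListP.map-tabulate (λ i → i) h)

  ΣFin-cong : ∀ n {h h′ : Fin n → ℕ} → (∀ i → h i ≡ h′ i) → ΣFin n h ≡ ΣFin n h′
  ΣFin-cong zero    eq = refl
  ΣFin-cong (suc n) eq = cong₂ _+_ (eq fzero) (ΣFin-cong n (eq ∘ fsuc))

  ΣFin-zero : ∀ n → ΣFin n (λ _ → 0) ≡ 0
  ΣFin-zero zero    = refl
  ΣFin-zero (suc n) = ΣFin-zero n

  ΣFin-+ : ∀ n (h h′ : Fin n → ℕ) → ΣFin n (λ i → h i + h′ i) ≡ ΣFin n h + ΣFin n h′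
  ΣFin-+ zero    h h′ = refl
  ΣFin-+ (suc n) h h′ rewrite ΣFin-+ n (h ∘ fsuc) (h′ ∘ fsuc) =
    solve 4 (λ a b c e → (a :+ b) :+ (c :+ e) := (a :+ c) :+ (b :+ e)) refl
      (h fzero) (h′ fzero) (ΣFin n (h ∘ fsuc)) (ΣFin n (h′ ∘ fsuc))

  cellWeightFin : {d n : ℕ} → (ℕ → ℕ → ℕ) → Subsetᴬ d n → ℕ
  cellWeightFin {d} {n} κ M = ΣFin d (λ i → ΣFin n (λ j → if mem M i j then κ (toℕ i) (toℕ j) else 0))

  colWeight-Fin : ∀ {d} (g : ℕ → ℕ) (c : Vec Bool d) →
    ΣFin d (λ i → if lookup c i then g (toℕ i) else 0) ≡ colWeight g c
  colWeight-Fin g []      = refl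
  colWeight-Fin g (x ∷ c) = cong ((if x then g 0 else 0) +_) (colWeight-Fin (g ∘ suc) c)

  cellWeightFin-transpose : ∀ {d n} κ (C : Vec (Vec Bool d) n) → cellWeightFin κ (transpose C) ≡ colsWeight κ C
  cellWeightFin-transpose {d} κ [] = ΣFin-zero d
  cellWeightFin-transpose {d} {suc n} κ (c ∷ C) = begin
    cellWeightFin κ (c ∷ᶜ transpose C)
      ≡⟨ ΣFin-cong d (λ i → cong (λ row → ΣFin (suc n) (λ j → if lookup row j then κ (toℕ i) (toℕ j) else 0))
                                 (lookup-∷ᶜ c (transpose C) i)) ⟩
    ΣFin d (λ i → (if lookup c i then κ (toℕ i) 0 else 0)
                 + ΣFin n (λ j → if mem (transpose C) i j then κ (toℕ i) (suc (toℕ j)) else 0))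
      ≡⟨ ΣFin-+ d _ _ ⟩
    ΣFin d (λ i → if lookup c i then κ (toℕ i) 0 else 0) + cellWeightFin (λ i j → κ i (suc j)) (transpose C)
      ≡⟨ cong₂ _+_ (colWeight-Fin (λ i → κ i 0) c) (cellWeightFin-transpose (λ i j → κ i (suc j)) C) ⟩
    colsWeight κ (c ∷ C) ∎
    where open ≡-Reasoning

  cellWeight-transpose : ∀ {d n} κ (C : Vec (Vec Bool d) n) → cellWeight κ (transpose C) ≡ colsWeight κ C
  cellWeight-transpose {d} {n} κ C =
    trans (trans (ΣL-cong (allFin d) (λ i → ΣL-allFin n _)) (ΣL-allFin d _)) (cellWeightFin-transpose κ C)

module Configurations where

  open import Data.Bool using (Bool; true; false; _∧_; _∨_; not; if_then_else_)
  open import Data.Nat using (ℕ; zero; suc; _+_; _*_; _^_)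
  import Data.Nat.Properties as ℕP
  open import Data.Vec using (Vec; []; _∷_; replicate; transpose)
  open import Data.List using (List; []; _∷_; map; _++_)
  open import Data.Product using (_×_; _,_; proj₁; proj₂)
  open import Function using (_∘_)
  open import Relation.Binary.PropositionalEquality
  open import Defs
  open FiniteSums
  open Columns

  isPrefix-true : ∀ {d} (c : Vec Bool d) → isPrefix (true ∷ c) ≡ isPrefix c
  isPrefix-true []          = refl
  isPrefix-true (true ∷ c)  = refl
  isPrefix-true (false ∷ c) = refl

  -- below an empty cell only the empty column remains
  ΣL-isPrefix-false : ∀ d (Φ : Vec Bool d → ℕ) →
    ΣL (allVecs bools d) (λ c → if isPrefix (false ∷ c) then Φ c else 0) ≡ Φ (replicate d false)
  ΣL-isPrefix-false zero    Φ = ℕP.+-identityʳ _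
  ΣL-isPrefix-false (suc d) Φ = trans (ΣL-allVecs-suc bools d _)
    (cong₂ _+_ (ΣL-zero (allVecs bools d)) (trans (ℕP.+-identityʳ _) (ΣL-isPrefix-false d (Φ ∘ (false ∷_)))))

  colWeight-empty : ∀ d g → colWeight g (replicate d false) ≡ 0
  colWeight-empty zero    g = refl
  colWeight-empty (suc d) g = colWeight-empty d (g ∘ suc)

  -- Summing a statistic Ψ (top cell, weight, height) over the prefix columns
  -- of height ≤ d: the empty column, and one column of each height h+1 ≤ d.
  ΣL-prefixColumns : ∀ d (g : ℕ → ℕ) (Ψ : Bool → ℕ → ℕ → ℕ) →
    ΣL (allVecs bools d) (λ c → if isPrefix c then Ψ (topCell c) (colWeight g c) (colWeight (λ _ → 1) c) else 0)
    ≡ Ψ false 0 0 + Σ< d (λ h → Ψ true (Σ< (suc h) g) (suc h))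
  ΣL-prefixColumns zero    g Ψ = refl
  ΣL-prefixColumns (suc d) g Ψ = begin
    ΣL (allVecs bools (suc d)) (λ c → if isPrefix c then Ψ (topCell c) (colWeight g c) (colWeight one c) else 0)
      ≡⟨ ΣL-allVecs-suc bools d _ ⟩
    full + (empty + 0)
      ≡⟨ cong₂ _+_ full≡ (trans (ℕP.+-identityʳ empty) empty≡) ⟩
    (Ψ true (g 0 + 0) 1 + Σ< d (λ h → Ψ true (g 0 + Σ< (suc h) (g ∘ suc)) (suc (suc h)))) + Ψ false 0 0
      ≡⟨ ℕP.+-comm _ (Ψ false 0 0) ⟩
    Ψ false 0 0 + Σ< (suc d) (λ h → Ψ true (Σ< (suc h) g) (suc h)) ∎
    where
    open ≡-Reasoning
    one : ℕ → ℕ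
    one _ = 1
    full  = ΣL (allVecs bools d) (λ v → if isPrefix (true ∷ v)
              then Ψ true (g 0 + colWeight (g ∘ suc) v) (suc (colWeight one v)) else 0)
    empty = ΣL (allVecs bools d) (λ v → if isPrefix (false ∷ v)
              then Ψ false (colWeight (g ∘ suc) v) (colWeight one v) else 0)
    full≡ : full ≡ Ψ true (g 0 + 0) 1 + Σ< d (λ h → Ψ true (g 0 + Σ< (suc h) (g ∘ suc)) (suc (suc h)))
    full≡ = trans (ΣL-cong (allVecs bools d) (λ v →
                    cong (λ z → if z then Ψ true (g 0 + colWeight (g ∘ suc) v) (suc (colWeight one v)) else 0)
                         (isPrefix-true v)))
                  (ΣL-prefixColumns d (g ∘ suc) (λ t s k → Ψ true (g 0 + s) (suc k)))
    empty≡ : empty ≡ Ψ false 0 0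
    empty≡ = trans (ΣL-isPrefix-false d (λ v → Ψ false (colWeight (g ∘ suc) v) (colWeight one v)))
                   (cong₂ (Ψ false) (colWeight-empty d (g ∘ suc)) (colWeight-empty d one))

  -- A nice set is recorded only through the pair (σ_m, |·|).
  -- configs m d n o free lists these pairs for nice column lists of n columns
  -- of height d, the first of which is column o+1; `free` says whether its top
  -- cell may be used.  A non-empty column of height h+1 at position o+1
  -- contributes Σ_{i ≤ h} (i·m + o + 1) to σ_m and h+1 to the cardinality,
  -- and blocks the top cell of the next column.

  rowWeight : ℕ → ℕ → ℕ → ℕ
  rowWeight m o i = i * m + suc o

  columnσ : ℕ → ℕ → ℕ → ℕ
  columnσ m o h = Σ< (suc h) (rowWeight m o)

  shift : ℕ → ℕ → ℕ × ℕ → ℕ × ℕ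
  shift s k (x , y) = (s + x , k + y)

  configs : (m d n o : ℕ) → Bool → List (ℕ × ℕ)
  configs m d zero    o free  = (0 , 0) ∷ []
  configs m d (suc n) o true  = configs m d n (suc o) true
                             ++ ⋃< d (λ h → map (shift (columnσ m o h) (suc h)) (configs m d n (suc o) false))
  configs m d (suc n) o false = configs m d n (suc o) true

  σCols : {d n : ℕ} → ℕ → ℕ → Vec (Vec Bool d) n → ℕ
  σCols m o C = colsWeight (λ i j → i * m + suc (o + j)) C

  cardCols : {d n : ℕ} → Vec (Vec Bool d) n → ℕ
  cardCols C = colsWeight (λ _ _ → 1) C

  σCols-cons : ∀ {d n} m o (c : Vec Bool d) (C : Vec (Vec Bool d) n) →
    σCols m o (c ∷ C) ≡ colWeight (rowWeight m o) c + σCols m (suc o) C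
  σCols-cons m o c C = cong₂ _+_
    (colWeight-cong c (λ i → cong (λ z → i * m + suc z) (ℕP.+-identityʳ o)))
    (colsWeight-cong C (λ i j → cong (λ z → i * m + suc z) (ℕP.+-suc o j)))

  if-∧ : ∀ p q r (X : ℕ) → (if p ∧ (q ∧ r) then X else 0) ≡ (if p then (if q then (if r then X else 0) else 0) else 0)
  if-∧ true  true  r X = refl
  if-∧ true  false r X = refl
  if-∧ false q     r X = refl

  ΣL-if-if : {X : Set} (L : List X) (p q : Bool) (f : X → ℕ) →
    ΣL L (λ x → if p then (if q then f x else 0) else 0) ≡ (if p then (if q then ΣL L f else 0) else 0)
  ΣL-if-if L true  true  f = refl
  ΣL-if-if L true  false f = ΣL-zero L
  ΣL-if-if L false q     f = ΣL-zero L

  ΣL-niceCols : ∀ m d n o free (F : ℕ → ℕ → ℕ) →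
    ΣL (allVecs (allVecs bools d) n) (λ C → if niceCols free C then F (σCols m o C) (cardCols C) else 0)
    ≡ ΣL (configs m d n o free) (λ p → F (proj₁ p) (proj₂ p))
  ΣL-niceCols m d zero    o free F = refl
  ΣL-niceCols m d (suc n) o free F = begin
    ΣL (allVecs Col (suc n)) (λ C → if niceCols free C then F (σCols m o C) (cardCols C) else 0)
      ≡⟨ ΣL-allVecs-suc Col n _ ⟩
    ΣL Col (λ c → ΣL Rest (λ C → if niceCols free (c ∷ C) then F (σCols m o (c ∷ C)) (cardCols (c ∷ C)) else 0))
      ≡⟨ ΣL-cong Col (λ c → ΣL-cong Rest (λ C → trans
           (cong (λ z → if niceCols free (c ∷ C) then F z (cardCols (c ∷ C)) else 0) (σCols-cons m o c C))
           (if-∧ (isPrefix c) (free ∨ not (topCell c)) (niceCols (not (topCell c)) C) _))) ⟩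
    ΣL Col (λ c → ΣL Rest (λ C → if isPrefix c then (if free ∨ not (topCell c) then
        (if niceCols (not (topCell c)) C then F (colWeight (rowWeight m o) c + σCols m (suc o) C)
                                                (colWeight (λ _ → 1) c + cardCols C) else 0) else 0) else 0))
      ≡⟨ ΣL-cong Col (λ c → trans (ΣL-if-if Rest (isPrefix c) (free ∨ not (topCell c)) _)
           (cong (λ z → if isPrefix c then (if free ∨ not (topCell c) then z else 0) else 0)
             (ΣL-niceCols m d n (suc o) (not (topCell c))
                (λ x y → F (colWeight (rowWeight m o) c + x) (colWeight (λ _ → 1) c + y))))) ⟩
    ΣL Col (λ c → if isPrefix c then Ψ (topCell c) (colWeight (rowWeight m o) c) (colWeight (λ _ → 1) c) else 0)
      ≡⟨ ΣL-prefixColumns d (rowWeight m o) Ψ ⟩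
    Ψ false 0 0 + Σ< d (λ h → Ψ true (columnσ m o h) (suc h))
      ≡⟨ regroup free ⟩
    ΣL (configs m d (suc n) o free) G ∎
    where
    open ≡-Reasoning
    Col  = allVecs bools d
    Rest = allVecs Col n
    G : ℕ × ℕ → ℕ
    G p = F (proj₁ p) (proj₂ p)
    -- contribution of a first column with top cell t, weight s and height k
    Ψ : Bool → ℕ → ℕ → ℕ
    Ψ t s k = if free ∨ not t then ΣL (configs m d n (suc o) (not t)) (λ p → F (s + proj₁ p) (k + proj₂ p)) else 0
    regroup : ∀ free′ → (if free′ ∨ true then ΣL (configs m d n (suc o) true) G else 0)
        + Σ< d (λ h → if free′ ∨ false
                      then ΣL (configs m d n (suc o) false) (λ p → F (columnσ m o h + proj₁ p) (suc h + proj₂ p))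
                      else 0)
        ≡ ΣL (configs m d (suc n) o free′) G
    regroup true  = sym (trans (ΣL-++ (configs m d n (suc o) true) _ G)
      (cong (ΣL (configs m d n (suc o) true) G +_) (trans (ΣL-⋃< d _ G)
        (Σ<-cong d (λ h → ΣL-map (shift (columnσ m o h) (suc h)) (configs m d n (suc o) false) G)))))
    regroup false = trans (cong (ΣL (configs m d n (suc o) true) G +_) (Σ<-zero d)) (ℕP.+-identityʳ _)

  moment : (m d n o : ℕ) → Bool → ℕ → ℕ → ℕ
  moment m d n o free a b = ΣL (configs m d n o free) (λ p → proj₁ p ^ a * proj₂ p ^ b)

  G⁺≡moment : ∀ m d n a b → G⁺ d m a b n ≡ moment m d n 0 true a b
  G⁺≡moment m d n a b = begin
    G⁺ d m a b n
      ≡⟨ ΣL-filter nice weight (allSubsets d n) ⟩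
    ΣL (allSubsets d n) (λ M → if nice M then weight M else 0)
      ≡⟨ ΣL-transpose bools n d _ ⟩
    ΣL (allVecs (allVecs bools d) n) (λ C → if nice (transpose C) then weight (transpose C) else 0)
      ≡⟨ ΣL-cong (allVecs (allVecs bools d) n) (λ C →
           cong₂ (λ z w → if z then w else 0) (nice-transpose C)
             (cong₂ (λ x y → x ^ a * y ^ b) (cellWeight-transpose (λ i j → i * m + suc j) C)
                                            (cellWeight-transpose (λ _ _ → 1) C))) ⟩
    ΣL (allVecs (allVecs bools d) n) (λ C → if niceCols true C then σCols m 0 C ^ a * cardCols C ^ b else 0)
      ≡⟨ ΣL-niceCols m d n 0 true (λ x y → x ^ a * y ^ b) ⟩
    moment m d n 0 true a b ∎
    where
    open ≡-Reasoning
    weight : Subsetᴬ d n → ℕ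
    weight I = σ m I ^ a * card I ^ b

module MomentRecursion where

  open import Data.Bool using (Bool; true; false; if_then_else_)
  open import Data.Nat using (ℕ; zero; suc; _+_; _*_; _∸_; _^_; _≤_; z≤n; s≤s)
  import Data.Nat.Properties as ℕP
  open import Data.Vec using (Vec; []; _∷_; replicate)
  open import Data.List using (List; map)
  open import Data.Product using (_×_; proj₁; proj₂)
  open import Relation.Binary.PropositionalEquality
  open import Data.Nat.Solver using (module +-*-Solver)
  open +-*-Solver
  open import Defs using (allVecs)
  open FiniteSums
  open Columns using (bools)
  open Configurations

  -- The binomial theorem, with the binomial coefficients realised as the
  -- number of boolean vectors u of length a with a given number of trues.

  count : {k : ℕ} → Vec Bool k → ℕ
  count []      = 0
  count (x ∷ v) = (if x then 1 else 0) + count v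

  count≤ : ∀ {k} (u : Vec Bool k) → count u ≤ k
  count≤ []          = z≤n
  count≤ (true ∷ u)  = s≤s (count≤ u)
  count≤ (false ∷ u) = ℕP.m≤n⇒m≤1+n (count≤ u)

  count-all-true : ∀ k → count (replicate k true) ≡ k
  count-all-true zero    = refl
  count-all-true (suc k) = cong suc (count-all-true k)

  binomial-theorem : ∀ a x y → (x + y) ^ a ≡ ΣL (allVecs bools a) (λ u → x ^ count u * y ^ (a ∸ count u))
  binomial-theorem zero    x y = refl
  binomial-theorem (suc a) x y = sym (begin
    ΣL (allVecs bools (suc a)) (λ u → x ^ count u * y ^ (suc a ∸ count u))
      ≡⟨ ΣL-allVecs-suc bools a _ ⟩
    ΣL Va (λ u → x ^ suc (count u) * y ^ (a ∸ count u)) + (ΣL Va (λ u → x ^ count u * y ^ (suc a ∸ count u)) + 0)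
      ≡⟨ cong₂ _+_ (trans (ΣL-cong Va (λ u → ℕP.*-assoc x (x ^ count u) (y ^ (a ∸ count u)))) (ΣL-*ˡ Va x term))
                   (trans (ℕP.+-identityʳ _) (trans (ΣL-cong Va pick-y) (ΣL-*ˡ Va y term))) ⟩
    x * S + y * S
      ≡⟨ sym (ℕP.*-distribʳ-+ S x y) ⟩
    (x + y) * S
      ≡⟨ cong ((x + y) *_) (sym (binomial-theorem a x y)) ⟩
    (x + y) ^ suc a ∎)
    where
    open ≡-Reasoning
    Va = allVecs bools a
    term : Vec Bool a → ℕ
    term u = x ^ count u * y ^ (a ∸ count u)
    S = ΣL Va term
    pick-y : ∀ u → x ^ count u * y ^ (suc a ∸ count u) ≡ y * term u
    pick-y u rewrite ℕP.+-∸-assoc 1 (count≤ u) =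
      solve 3 (λ X y Y → X :* (y :* Y) := y :* (X :* Y)) refl (x ^ count u) y (y ^ (a ∸ count u))

  moment-shift : ∀ (L : List (ℕ × ℕ)) W H a b →
    ΣL L (λ p → (W + proj₁ p) ^ a * (H + proj₂ p) ^ b)
    ≡ ΣL (allVecs bools a) (λ u → ΣL (allVecs bools b) (λ v → (W ^ count u * H ^ count v) *
         ΣL L (λ p → proj₁ p ^ (a ∸ count u) * proj₂ p ^ (b ∸ count v))))
  moment-shift L W H a b = begin
    ΣL L (λ p → (W + proj₁ p) ^ a * (H + proj₂ p) ^ b)
      ≡⟨ ΣL-cong L expand ⟩
    ΣL L (λ p → ΣL Va (λ u → ΣL Vb (λ v → K u v * rest p u v)))
      ≡⟨ ΣL-swap L Va _ ⟩
    ΣL Va (λ u → ΣL L (λ p → ΣL Vb (λ v → K u v * rest p u v)))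
      ≡⟨ ΣL-cong Va (λ u → ΣL-swap L Vb _) ⟩
    ΣL Va (λ u → ΣL Vb (λ v → ΣL L (λ p → K u v * rest p u v)))
      ≡⟨ ΣL-cong Va (λ u → ΣL-cong Vb (λ v → ΣL-*ˡ L (K u v) (λ p → rest p u v))) ⟩
    ΣL Va (λ u → ΣL Vb (λ v → K u v * ΣL L (λ p → rest p u v))) ∎
    where
    open ≡-Reasoning
    Va = allVecs bools a
    Vb = allVecs bools b
    K : Vec Bool a → Vec Bool b → ℕ
    K u v = W ^ count u * H ^ count v
    rest : ℕ × ℕ → Vec Bool a → Vec Bool b → ℕ
    rest p u v = proj₁ p ^ (a ∸ count u) * proj₂ p ^ (b ∸ count v)
    expand : ∀ p → (W + proj₁ p) ^ a * (H + proj₂ p) ^ b ≡ ΣL Va (λ u → ΣL Vb (λ v → K u v * rest p u v))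
    expand p = begin
      (W + proj₁ p) ^ a * (H + proj₂ p) ^ b
        ≡⟨ cong₂ _*_ (binomial-theorem a W (proj₁ p)) (binomial-theorem b H (proj₂ p)) ⟩
      ΣL Va fa * ΣL Vb fb
        ≡⟨ sym (ΣL-*ʳ Va (ΣL Vb fb) fa) ⟩
      ΣL Va (λ u → fa u * ΣL Vb fb)
        ≡⟨ ΣL-cong Va (λ u → sym (ΣL-*ˡ Vb (fa u) fb)) ⟩
      ΣL Va (λ u → ΣL Vb (λ v → fa u * fb v))
        ≡⟨ ΣL-cong Va (λ u → ΣL-cong Vb (λ v →
             solve 4 (λ A B C D → (A :* B) :* (C :* D) := (A :* C) :* (B :* D)) refl
               (W ^ count u) (proj₁ p ^ (a ∸ count u)) (H ^ count v) (proj₂ p ^ (b ∸ count v)))) ⟩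
      ΣL Va (λ u → ΣL Vb (λ v → K u v * rest p u v)) ∎
      where
      fa : Vec Bool a → ℕ
      fa u = W ^ count u * proj₁ p ^ (a ∸ count u)
      fb : Vec Bool b → ℕ
      fb v = H ^ count v * proj₂ p ^ (b ∸ count v)

  newColumnMoment : (m o e f d : ℕ) → ℕ
  newColumnMoment m o e f d = Σ< d (λ h → columnσ m o h ^ e * suc h ^ f)

  -- The column recursion for moments: the first column is either empty
  -- (the rest starts free) or non-empty of some height, whose contribution is
  -- expanded binomially (the rest then starts blocked).
  moment-recursion : ∀ m d n o a b → moment m d (suc n) o true a b ≡ moment m d n (suc o) true a b +
    ΣL (allVecs bools a) (λ u → ΣL (allVecs bools b) (λ v →
      newColumnMoment m o (count u) (count v) d * moment m d n (suc o) false (a ∸ count u) (b ∸ count v)))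
  moment-recursion m d n o a b =
    trans (ΣL-++ (configs m d n (suc o) true) _ G) (cong (moment m d n (suc o) true a b +_) (begin
    ΣL (⋃< d (λ h → map (shift (columnσ m o h) (suc h)) Blocked)) G
      ≡⟨ ΣL-⋃< d _ G ⟩
    Σ< d (λ h → ΣL (map (shift (columnσ m o h) (suc h)) Blocked) G)
      ≡⟨ Σ<-cong d (λ h → trans (ΣL-map (shift (columnσ m o h) (suc h)) Blocked G)
                               (moment-shift Blocked (columnσ m o h) (suc h) a b)) ⟩
    Σ< d (λ h → ΣL Va (λ u → ΣL Vb (λ v → K h u v * R u v)))
      ≡⟨ Σ<-ΣL d Va (λ h u → ΣL Vb (λ v → K h u v * R u v)) ⟩
    ΣL Va (λ u → Σ< d (λ h → ΣL Vb (λ v → K h u v * R u v)))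
      ≡⟨ ΣL-cong Va (λ u → trans (Σ<-ΣL d Vb (λ h v → K h u v * R u v))
                                 (ΣL-cong Vb (λ v → Σ<-*ʳ d (λ h → K h u v) (R u v)))) ⟩
    ΣL Va (λ u → ΣL Vb (λ v → newColumnMoment m o (count u) (count v) d * R u v)) ∎))
    where
    open ≡-Reasoning
    G : ℕ × ℕ → ℕ
    G p = proj₁ p ^ a * proj₂ p ^ b
    Blocked = configs m d n (suc o) false
    Va = allVecs bools a
    Vb = allVecs bools b
    K : ℕ → Vec Bool a → Vec Bool b → ℕ
    K h u v = columnσ m o h ^ count u * suc h ^ count v
    R : Vec Bool a → Vec Bool b → ℕ
    R u v = moment m d n (suc o) false (a ∸ count u) (b ∸ count v)

module DegreeBounds where

  open import Data.Bool using (Bool; true; false)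
  open import Data.Nat using (ℕ; zero; suc; _+_; _*_; _∸_; _^_; _≤_; _/_; z≤n; s≤s)
  import Data.Nat.Properties as ℕP
  import Data.Nat.DivMod as ℕD
  open import Data.Vec using (Vec; replicate)
  open import Data.List.Membership.Propositional using (_∈_)
  open import Data.List.Relation.Unary.Any using (here; there)
  open import Relation.Binary.PropositionalEquality
  open import Data.Nat.Solver using (module +-*-Solver)
  open +-*-Solver
  open import Defs
  open FiniteSums
  open PolynomialFunctions
  open Columns using (bools)
  open Configurations
  open MomentRecursion

  -- Degrees.  With n columns left, at most ⌈n/2⌉ of them can be non-empty if
  -- the first one is free and ⌊n/2⌋ if it is blocked; each non-empty column
  -- contributes one more power of d.

  degFree : ℕ → ℕ → ℕ → ℕ
  degFree n a b = 2 * a + b + (n + 1) / 2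

  degBlocked : ℕ → ℕ → ℕ → ℕ
  degBlocked n a b = 2 * a + b + n / 2

  degFree-mono : ∀ n a b → degFree n a b ≤ degFree (suc n) a b
  degFree-mono n a b = ℕP.+-monoʳ-≤ (2 * a + b) (ℕD./-mono-≤ (ℕP.n≤1+n (n + 1)) ℕP.≤-refl)

  degBlocked-suc : ∀ n a b → degBlocked (suc n) a b ≡ degFree n a b
  degBlocked-suc n a b = cong (λ z → 2 * a + b + z / 2) (ℕP.+-comm 1 n)

  half-suc : ∀ n → (suc n + 1) / 2 ≡ suc (n / 2)
  half-suc n = trans (ℕD.m/n≡1+[m∸n]/n {suc (n + 1)} {2} (s≤s (ℕP.m≤n+m 1 n)))
                     (cong (λ z → suc (z / 2)) (ℕP.m+n∸n≡m n 1))

  -- A new column carrying e factors of σ (degree 2 each) and f factors of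
  -- the cardinality (degree 1 each), followed by a blocked rest, has the
  -- degree of a free configuration with one more column.
  degFree-split : ∀ n a b e f → e ≤ a → f ≤ b →
    suc (e * 2 + f * 1) + degBlocked n (a ∸ e) (b ∸ f) ≡ degFree (suc n) a b
  degFree-split n a b e f e≤a f≤b = begin
    suc (e * 2 + f * 1) + (2 * (a ∸ e) + (b ∸ f) + n / 2)
      ≡⟨ solve 5 (λ e f a′ b′ k → con 1 :+ (e :* con 2 :+ f :* con 1) :+ (con 2 :* a′ :+ b′ :+ k)
                                := con 2 :* (e :+ a′) :+ (f :+ b′) :+ (con 1 :+ k))
           refl e f (a ∸ e) (b ∸ f) (n / 2) ⟩
    2 * (e + (a ∸ e)) + (f + (b ∸ f)) + suc (n / 2)
      ≡⟨ cong₂ (λ x y → 2 * x + y + suc (n / 2)) (ℕP.m+[n∸m]≡n e≤a) (ℕP.m+[n∸m]≡n f≤b) ⟩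
    2 * a + b + suc (n / 2)
      ≡⟨ cong (2 * a + b +_) (sym (half-suc n)) ⟩
    degFree (suc n) a b ∎
    where open ≡-Reasoning

  ∈-bools : ∀ x → x ∈ bools
  ∈-bools true  = here refl
  ∈-bools false = there (here refl)

  module Bounds (m′ : ℕ) where

    m : ℕ
    m = suc m′

    -- the weight i·m + o + 1 of row i is linear in i (here m ≥ 1 is used)
    rowWeight-posLead : ∀ o → PosLead (rowWeight m o) 1
    rowWeight-posLead o =
      pos+nonNeg-lead (*-posLead id-posLead (const-posLead m′)) (nonNegLead-weaken z≤n (const-nonNegLead (suc o)))

    columnσ-posLead : ∀ o → PosLead (columnσ m o) 2
    columnσ-posLead o = posLead-ext (λ h → sym (Σ<-snoc h (rowWeight m o)))
      (pos+nonNeg-lead (Σ<-posLead (rowWeight-posLead o))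
                       (nonNegLead-weaken (s≤s z≤n) (pos⇒nonNegLead (rowWeight-posLead o))))

    newColumnMoment-posLead : ∀ o e f → PosLead (newColumnMoment m o e f) (suc (e * 2 + f * 1))
    newColumnMoment-posLead o e f =
      Σ<-posLead (*-posLead (^-posLead (columnσ-posLead o) e) (^-posLead suc-posLead f))

    record MomentBounds (n : ℕ) : Set where
      field
        blocked-nonNeg : ∀ o a b → NonNegLead (λ d → moment m d n o false a b) (degBlocked n a b)
        free-nonNeg    : ∀ o a b → NonNegLead (λ d → moment m d n o true a b) (degFree n a b)
        blocked-count  : ∀ o → PosLead (λ d → moment m d n o false 0 0) (degBlocked n 0 0)
        free-count     : ∀ o → PosLead (λ d → moment m d n o true 0 0) (degFree n 0 0)

    bounds-zero : MomentBounds 0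
    bounds-zero = record
      { blocked-nonNeg = λ o a b → empty o false a b
      ; free-nonNeg    = λ o a b → empty o true a b
      ; blocked-count  = λ o → const-posLead 0
      ; free-count     = λ o → const-posLead 0
      }
      where
      empty : ∀ o free a b → NonNegLead (λ d → moment m d 0 o free a b) (2 * a + b + 0)
      empty o free a b = nonNegLead-weaken z≤n
        (nonNegLead-ext (λ d → sym (ℕP.+-identityʳ _)) (const-nonNegLead (0 ^ a * 0 ^ b)))

    -- The moment recursion preserves the bounds, and a free first column
    -- gives the exact degree: the term in which all a + b binomial factors
    -- come from the new column is a product of positive-leading factors.
    module Step (n : ℕ) (hyp : MomentBounds n) (o a b : ℕ) where
      open MomentBounds hyp

      term : Vec Bool a → Vec Bool b → ℕ → ℕ
      term u v d = newColumnMoment m o (count u) (count v) d * moment m d n (suc o) false (a ∸ count u) (b ∸ count v)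

      term-nonNeg : ∀ u v → NonNegLead (term u v) (degFree (suc n) a b)
      term-nonNeg u v = subst (NonNegLead (term u v)) (degFree-split n a b (count u) (count v) (count≤ u) (count≤ v))
        (*-nonNegLead (pos⇒nonNegLead (newColumnMoment-posLead o (count u) (count v)))
                      (blocked-nonNeg (suc o) (a ∸ count u) (b ∸ count v)))

      blocked-count′ : ∀ x y → x ≡ 0 → y ≡ 0 → PosLead (λ d → moment m d n (suc o) false x y) (degBlocked n x y)
      blocked-count′ .0 .0 refl refl = blocked-count (suc o)

      term-pos : ∀ (u : Vec Bool a) (v : Vec Bool b) → count u ≡ a → count v ≡ b →
        PosLead (term u v) (degFree (suc n) a b)
      term-pos u v cu cv = subst (PosLead (term u v)) (degFree-split n a b (count u) (count v) (count≤ u) (count≤ v))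
        (*-posLead (newColumnMoment-posLead o (count u) (count v))
                   (blocked-count′ (a ∸ count u) (b ∸ count v)
                     (trans (cong (a ∸_) cu) (ℕP.n∸n≡0 a)) (trans (cong (b ∸_) cv) (ℕP.n∸n≡0 b))))

      inner : Vec Bool a → ℕ → ℕ
      inner u d = ΣL (allVecs bools b) (λ v → term u v d)

      all-a = replicate a true
      all-b = replicate b true

      new-column-pos : PosLead (λ d → ΣL (allVecs bools a) (λ u → inner u d)) (degFree (suc n) a b)
      new-column-pos = ΣL-posLead inner (∈-allVecs ∈-bools all-a)
        (ΣL-posLead (term all-a) (∈-allVecs ∈-bools all-b)
          (term-pos all-a all-b (count-all-true a) (count-all-true b)) (term-nonNeg all-a))
        (λ u → ΣL-nonNegLead (allVecs bools b) (term u) (term-nonNeg u))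

      free-posLead : PosLead (λ d → moment m d (suc n) o true a b) (degFree (suc n) a b)
      free-posLead = posLead-ext (λ d → sym (moment-recursion m d n o a b))
        (nonNeg+pos-lead (nonNegLead-weaken (degFree-mono n a b) (free-nonNeg (suc o) a b)) new-column-pos)

    bounds-suc : ∀ n → MomentBounds n → MomentBounds (suc n)
    bounds-suc n hyp = record
      { blocked-nonNeg = λ o a b → subst (NonNegLead (λ d → moment m d n (suc o) true a b))
                                          (sym (degBlocked-suc n a b)) (free-nonNeg (suc o) a b)
      ; free-nonNeg    = λ o a b → pos⇒nonNegLead (Step.free-posLead n hyp o a b)
      ; blocked-count  = λ o → subst (PosLead (λ d → moment m d n (suc o) true 0 0))
                                     (sym (degBlocked-suc n 0 0)) (free-count (suc o))
      ; free-count     = λ o → Step.free-posLead n hyp o 0 0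
      }
      where open MomentBounds hyp

    bounds : ∀ n → MomentBounds n
    bounds zero    = bounds-zero
    bounds (suc n) = bounds-suc n (bounds n)

open import Data.Nat using (ℕ; suc; _≤_; _+_; _*_; _/_)
open import Relation.Binary.PropositionalEquality using (sym)
open import Defs using (G⁺; IsPolyOfDegree)
open PolynomialFunctions using (posLead⇒isPolyOfDegree; posLead-ext)
open Configurations using (G⁺≡moment)
open DegreeBounds using (module Bounds)

theorem4p5 : (m n a b : ℕ) → 1 ≤ m → 1 ≤ n →
    IsPolyOfDegree (λ d → G⁺ d m a b n) (2 * a + b + (n + 1) / 2)
theorem4p5 (suc m′) (suc n) a b _ _ =
  posLead⇒isPolyOfDegree
    (posLead-ext (λ d → sym (G⁺≡moment (suc m′) d (suc n) a b))
      (Step.free-posLead n (bounds n) 0 a b))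
  where open Bounds m′
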